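{- Let $D'$ and $D$ be sorted columns of the same height with entries in $[\overline{n}]$. Let $D_+,D'_+$ be their sets of entries in $[n]$ and $D_-,D'_-$ their sets of entries in $[\overline{n}]\setminus[n]$. The following are equivalent: (1) the pair $D'D$ satisfies Conditions R1, R2 and R3; (2) $|D'_-|=\mathrm{maxcol}(|D_-|,D'_+)$ and $D_+=(D'_+\cup|D'_-|)\setminus|D_-|$; (3) there is a KN column $E$ whose entries in $[n]$ are exactly $D'_+$ and whose entries in $[\overline{n}]\setminus[n]$ are exactly $D_-$, and $D'=rE$, $D=lE$.
   Context: $[\overline{n}]=\{1<\dots<n<\overline{n}<\dots<\overline{1}\}$, $|\overline{\imath}|=|i|=i$; for a set $X$, $|X|$ is the set of absolute values. A sorted column is a strictly increasing sequence in $[\overline{n}]$ containing no pair $i,\overline{\imath}$. For columns $C'C$ of height $k$ (entries $C(1),\dots,C(k)$ etc.): Condition R1: $\{|C(i)|\}_{i=1}^k=\{|C'(i)|\}_{i=1}^k$. Condition R2: for each $i$, $C(i)\le C'(i)\le n$ or $\overline{n}\le C(i)\le C'(i)$. Condition R3: $\mathrm{int}(C,C')=\emptyset$, where $\mathrm{int}(C,C')=\bigl(\bigcup_{i=1}^k\{j\in[\overline{n}]:C(i)<j<C'(i)\}\bigr)\setminus\{C(i),\overline{C(i)}:1\le i\le k\}$. For finite sets of integers $A=\{a_1<\dots<a_k\}$ and $B$, $\mathrm{maxcol}(A,B)$ is the set $\{c_1<\dots<c_k\}$ defined by $c_k=\max\{c\in\mathbb Z:c\le a_k\}\setminus B$ and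 $c_i=\max\{c\in\mathbb Z:c\le a_i,\ c<c_{i+1}\}\setminus B$ for $i=k-1,\dots,1$ (the entrywise maximal $k$-set $C\le A$ disjoint from $B$). KN columns: for strictly increasing $E$ in $[\overline{n}]$, $I=\{z_1>\dots>z_r\}$ the $z\in[n]$ with $z,\overline z\in E$; $E$ can be split if there are $t_1>\dots>t_r$ in $[n]$ with $t_1$ greatest such that $t_1<z_1$, $t_1,\overline{t_1}\notin E$, and $t_i$ greatest with $t_i<\min(t_{i-1},z_i)$, $t_i,\overline{t_i}\notin E$; $rE$ replaces each $\overline{z_i}$ by $\overline{t_i}$ and sorts; $lE$ replaces each $z_i$ by $t_i$ and sorts; a KN column is one that can be split. -}

module Defs where

open import Data.Nat using (ℕ; _≤_; _<_; _≡ᵇ_)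
open import Data.Integer as ℤ using (ℤ; +_)
open import Data.Bool using (if_then_else_)
open import Data.Maybe using (Maybe; just; nothing)
open import Data.Product using (_×_; _,_; ∃; ∃-syntax)
open import Data.Sum using (_⊎_)
open import Data.Unit using (⊤)
open import Data.Empty using (⊥)
open import Data.List using (List; []; _∷_; map; zip; reverse; length)
open import Data.List.Membership.Propositional using (_∈_; _∉_)
open import Data.List.Relation.Unary.All using (All)
open import Data.List.Relation.Unary.AllPairs using (AllPairs)
open import Data.List.Relation.Binary.Pointwise using (Pointwise)
open import Data.List.Relation.Binary.Permutation.Propositional using (_↭_)
open import Relation.Nullary using (¬_)
open import Relation.Binary.PropositionalEquality using (_≡_)
open import Function.Bundles using (_⇔_)

-- The alphabet [n̄] = {1 < … < n < n̄ < … < 1̄}.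
-- pl i stands for the unbarred letter i, mi i for the barred letter ī.

data Ent : Set where
  pl : ℕ → Ent
  mi : ℕ → Ent

∣_∣ₑ : Ent → ℕ
∣ pl i ∣ₑ = i
∣ mi i ∣ₑ = i

bar : Ent → Ent
bar (pl i) = mi i
bar (mi i) = pl i

InRange : ℕ → Ent → Set
InRange n x = 1 ≤ ∣ x ∣ₑ × ∣ x ∣ₑ ≤ n

data _<ₑ_ : Ent → Ent → Set where
  pl<pl : ∀ {i j} → i < j → pl i <ₑ pl j
  pl<mi : ∀ {i j} → pl i <ₑ mi j
  mi<mi : ∀ {i j} → j < i → mi i <ₑ mi j

_≤ₑ_ : Ent → Ent → Set
x ≤ₑ y = x <ₑ y ⊎ x ≡ y

IncColumn : ℕ → List Ent → Set
IncColumn n C = All (InRange n) C × AllPairs _<ₑ_ C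

SortedColumn : ℕ → List Ent → Set
SortedColumn n C = IncColumn n C × (∀ i → ¬ (pl i ∈ C × mi i ∈ C))

-- values of the entries in [n] (C₊), and absolute values of entries in
-- [n̄]∖[n] (|C₋|), in column order
posVals : List Ent → List ℕ
posVals [] = []
posVals (pl i ∷ C) = i ∷ posVals C
posVals (mi i ∷ C) = posVals C

negVals : List Ent → List ℕ
negVals [] = []
negVals (pl i ∷ C) = negVals C
negVals (mi i ∷ C) = i ∷ negVals C

-- Conditions R1, R2, R3 for the pair C'C (C' left, C right).

R1 : List Ent → List Ent → Set
R1 C' C = ∀ x → (x ∈ map ∣_∣ₑ C) ⇔ (x ∈ map ∣_∣ₑ C')

R2 : ℕ → List Ent → List Ent → Set
R2 n C' C = Pointwise (λ c c' → (c ≤ₑ c' × c' ≤ₑ pl n) ⊎ (mi n ≤ₑ c × c ≤ₑ c')) C C'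

R3 : ℕ → List Ent → List Ent → Set
R3 n C' C = ∀ j → InRange n j →
  (∃[ c ] ∃[ c' ] ((c , c') ∈ zip C C' × c <ₑ j × j <ₑ c')) →
  (j ∈ C ⊎ bar j ∈ C)

GreatestZ : (ℤ → Set) → ℤ → Set
GreatestZ P c = P c × (∀ d → P d → d ℤ.≤ c)

BelowZ : Maybe ℤ → ℤ → Set
BelowZ nothing  x = ⊤
BelowZ (just u) x = x ℤ.< u

-- MaxcolDesc bound (a_i ∷ …) B (c_i ∷ …): processes indices downward,
-- bound = c_{i+1} (nothing for i = k).
MaxcolDesc : Maybe ℤ → List ℤ → List ℤ → List ℤ → Set
MaxcolDesc b [] B [] = ⊤
MaxcolDesc b (a ∷ as) B (c ∷ cs) =
  GreatestZ (λ x → x ℤ.≤ a × BelowZ b x × x ∉ B) c × MaxcolDesc (just c) as B cs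
MaxcolDesc b [] B (c ∷ cs) = ⊥
MaxcolDesc b (a ∷ as) B [] = ⊥

-- IsMaxcol A B C : for A = (a_1 < … < a_k) listed increasingly,
-- C (listed increasingly) equals maxcol(A, B).
IsMaxcol : List ℤ → List ℤ → List ℤ → Set
IsMaxcol A B C = MaxcolDesc nothing (reverse A) B (reverse C)

GreatestN : (ℕ → Set) → ℕ → Set
GreatestN P t = P t × (∀ u → P u → u ≤ t)

BelowN : Maybe ℕ → ℕ → Set
BelowN nothing  x = ⊤
BelowN (just u) x = x < u

Free : ℕ → List Ent → ℕ → Set
Free n E u = 1 ≤ u × u ≤ n × pl u ∉ E × mi u ∉ E

IsI : List Ent → List ℕ → Set
IsI E zs = AllPairs (λ a b → b < a) zs × (∀ z → (z ∈ zs) ⇔ (pl z ∈ E × mi z ∈ E))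

-- t_i greatest with t_i < min(t_{i-1}, z_i), t_i, t̄_i ∉ E
SplitFrom : ℕ → List Ent → Maybe ℕ → List ℕ → List ℕ → Set
SplitFrom n E p [] [] = ⊤
SplitFrom n E p (z ∷ zs) (t ∷ ts) =
  GreatestN (λ u → Free n E u × u < z × BelowN p u) t × SplitFrom n E (just t) zs ts
SplitFrom n E p [] (t ∷ ts) = ⊥
SplitFrom n E p (z ∷ zs) [] = ⊥

Splitting : ℕ → List Ent → List ℕ → List ℕ → Set
Splitting n E zs ts = IsI E zs × SplitFrom n E nothing zs ts

KN : ℕ → List Ent → Set
KN n E = IncColumn n E × ∃[ zs ] ∃[ ts ] Splitting n E zs ts

lookupPair : List (ℕ × ℕ) → ℕ → ℕ
lookupPair [] x = x
lookupPair ((z , t) ∷ ps) x = if x ≡ᵇ z then t else lookupPair ps x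

rSubst : List (ℕ × ℕ) → Ent → Ent
rSubst ps (pl x) = pl x
rSubst ps (mi x) = mi (lookupPair ps x)

lSubst : List (ℕ × ℕ) → Ent → Ent
lSubst ps (pl x) = pl (lookupPair ps x)
lSubst ps (mi x) = mi x

-- C is rE (resp. lE): C is sorted (hypothesis elsewhere) and is a
-- rearrangement of the substituted E
IsR : List Ent → List ℕ → List ℕ → List Ent → Set
IsR E zs ts C = C ↭ map (rSubst (zip zs ts)) E

IsL : List Ent → List ℕ → List ℕ → List Ent → Set
IsL E zs ts C = C ↭ map (lSubst (zip zs ts)) E

Cond1 : ℕ → List Ent → List Ent → Set
Cond1 n D' D = R1 D' D × R2 n D' D × R3 n D' D

Cond2 : List Ent → List Ent → Set
Cond2 D' D =
  IsMaxcol (reverse (map +_ (negVals D))) (map +_ (posVals D'))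
           (reverse (map +_ (negVals D')))
  × (∀ x → (x ∈ posVals D) ⇔ ((x ∈ posVals D' ⊎ x ∈ negVals D') × x ∉ negVals D))

Cond3 : ℕ → List Ent → List Ent → Set
Cond3 n D' D = ∃[ E ] ∃[ zs ] ∃[ ts ]
  ( IncColumn n E × Splitting n E zs ts
  × (∀ x → (pl x ∈ E) ⇔ (x ∈ posVals D'))
  × (∀ x → (mi x ∈ E) ⇔ (x ∈ negVals D))
  × IsR E zs ts D' × IsL E zs ts D )

-- Record a column C by the decreasing lists of its unbarred values C₊ and of the
-- absolute values |C₋| of its barred entries, and scan the values u = n, …, 1
-- downwards.  For sorted columns D′ D, each of the three conditions amounts to
-- the same bracket word: every u is in none of D₊, D′₊, |D₋|, |D′₋|, or in
-- exactly D′₊ and |D₋| (an opening), in exactly D₊ and |D′₋| (a closing), in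
-- exactly D₊ and D′₊, or in exactly |D₋| and |D′₋|; every closing has a pending
-- opening, and none is pending at the end or at a value of the first kind.
-- Pairing openings with closings in order gives the pairs of each formulation:
-- (|D(i)|, |D′(i)|) in R2 and R3, the entries of |D₋| and of maxcol(|D₋|, D′₊)
-- in (2), and (z_i, t_i) of the splitting of E in (3); what each condition
-- demands between paired values is exactly that no value of the first kind
-- occurs while an opening is pending.

module Submission where

open import Defs
open import Data.Nat using (ℕ; zero; suc; _≤_; _<_; _>_; _≥_; z≤n; s≤s; _≟_; _≤?_; _≡ᵇ_)
open import Data.Nat.Properties
open import Data.Integer as ℤ using (+_; -[1+_])
import Data.Integer.Properties as ℤ
open import Data.Bool using (Bool; true; false; T)
open import Data.Maybe using (Maybe; just; nothing)
import Data.Maybe as Maybe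
open import Data.List using (List; []; _∷_; _++_; _∷ʳ_; map; length; reverse; reverseAcc; zip)
open import Data.List.Properties using (reverse-involutive; length-++; ∷ʳ-++; unfold-reverse)
open import Data.List.Relation.Unary.All as All using (All; []; _∷_)
open import Data.List.Relation.Unary.All.Properties as All using (∷ʳ⁺)
open import Data.List.Relation.Unary.Any using (here; there)
import Data.List.Relation.Unary.Any.Properties as Any
open import Data.List.Relation.Unary.AllPairs as AllPairs using (AllPairs; []; _∷_)
import Data.List.Relation.Unary.AllPairs.Properties as AllPairsₚ
open import Data.List.Relation.Binary.Pointwise as Pointwise using (Pointwise; []; _∷_)
open import Data.List.Membership.Propositional using (_∈_; _∉_)
open import Data.List.Membership.Propositional.Properties using (∈-map⁺; ∈-map⁻)
open import Data.List.Relation.Binary.Disjoint.Propositional using (Disjoint)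
open import Data.List.Relation.Unary.Unique.Propositional using (Unique)
open import Data.List.Relation.Binary.Permutation.Propositional using (_↭_; ↭-sym)
open import Data.List.Relation.Binary.Permutation.Propositional.Properties using (∈-resp-↭; ++⁺ˡ; ++⁺ʳ)
import Data.List.Relation.Binary.Permutation.Propositional.Properties as ↭
open import Data.List.Relation.Binary.BagAndSetEquality using (∼bag⇒↭)
open import Data.List.Membership.Propositional.Properties.WithK using (unique∧set⇒bag)
open import Data.List.Membership.DecPropositional _≟_ using (_∈?_)
open import Data.Product using (Σ; ∃; _×_; _,_; proj₁; proj₂; map₁)
open import Data.Sum using (_⊎_; inj₁; inj₂; [_,_])
import Data.Sum as Sum
open import Data.Empty using (⊥; ⊥-elim)
open import Data.Unit using (⊤; tt)
open import Relation.Nullary using (¬_; Dec; yes; no)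
open import Relation.Binary.PropositionalEquality hiding ([_])
open import Relation.Binary.Definitions using (tri<; tri≈; tri>)
open import Data.List.Relation.Binary.Pointwise.Properties using (Pointwise-length)
open import Function.Base using (id; _∘_; flip)
open import Function.Bundles using (_⇔_; mk⇔; Equivalence)
open import Function.Construct.Symmetry using (⇔-sym)
open import Function.Construct.Identity using (⇔-id)
open import Function.Properties.Equivalence using () renaming (trans to ⇔-trans)
open import Data.Sum.Function.Propositional using (_⊎-⇔_)
open import Data.Product.Function.NonDependent.Propositional using (_×-⇔_)
open import Function.Related.TypeIsomorphisms using (¬-cong-⇔)
open import Function.Related.Propositional using (module EquationalReasoning)

open Equivalence using (to; from)

InSegment : ℕ → ℕ → Set
InSegment v e = 1 ≤ e × e ≤ v

Desc : ℕ → List ℕ → Set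
Desc v xs = AllPairs _>_ xs × All (InSegment v) xs

Desc-zero : ∀ {xs} → Desc 0 xs → xs ≡ []
Desc-zero {[]}    _                       = refl
Desc-zero {_ ∷ _} (_ , (1≤e , e≤0) ∷ _) = ⊥-elim (<-irrefl refl (≤-trans 1≤e e≤0))

Desc-∉ : ∀ {v xs} → Desc v xs → suc v ∉ xs
Desc-∉ (_ , ins) m = <-irrefl refl (proj₂ (All.lookup ins m))

Desc-<suc : ∀ {v xs} → Desc v xs → All (_< suc v) xs
Desc-<suc (_ , ins) = All.map (λ ib → s≤s (proj₂ ib)) ins

Desc-weaken : ∀ {v xs} → Desc v xs → Desc (suc v) xs
Desc-weaken (dec , ins) = dec , All.map (λ { (1≤e , e≤v) → 1≤e , m≤n⇒m≤1+n e≤v }) ins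

Desc-cons : ∀ {v xs} → Desc v xs → Desc (suc v) (suc v ∷ xs)
Desc-cons d@(dec , _) = Desc-<suc d ∷ dec , (s≤s z≤n , ≤-refl) ∷ proj₂ (Desc-weaken d)

-- One step of the scan u = v, v - 1, …, 1 through a list with Desc v; the flag
-- records whether u occurs.
data Strip (u : ℕ) : Bool → List ℕ → List ℕ → Set where
  strip : ∀ {xs} → Strip u true (u ∷ xs) xs
  skip  : ∀ {xs} → All (_< u) xs → Strip u false xs xs

strip-view : ∀ {v xs} → Desc (suc v) xs → ∃ λ b → ∃ λ xs′ → Strip (suc v) b xs xs′ × Desc v xs′
strip-view {v} {[]} _ = false , [] , skip [] , [] , []
strip-view {v} {e ∷ xs} (e>xs ∷ dec , (1≤e , e≤sv) ∷ ins) with e ≟ suc v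
... | yes refl = true , xs , strip , dec , All.zipWith (λ { (x<e , 1≤x , _) → 1≤x , ≤-pred x<e }) (e>xs , ins)
... | no e≢sv =
  false , e ∷ xs , skip (s≤s e≤v ∷ All.map (λ x<e → ≤-trans x<e (m≤n⇒m≤1+n e≤v)) e>xs) ,
  e>xs ∷ dec , (1≤e , e≤v) ∷ All.zipWith (λ { (x<e , 1≤x , _) → 1≤x , ≤-trans (<⇒≤ x<e) e≤v }) (e>xs , ins)
  where e≤v = ≤-pred (≤∧≢⇒< e≤sv e≢sv)

Strip-unique : ∀ {u b b′ xs xs₁ xs₂} → Strip u b xs xs₁ → Strip u b′ xs xs₂ → b ≡ b′ × xs₁ ≡ xs₂
Strip-unique strip            strip            = refl , refl
Strip-unique strip            (skip (u<u ∷ _)) = ⊥-elim (<-irrefl refl u<u)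
Strip-unique (skip (u<u ∷ _)) strip            = ⊥-elim (<-irrefl refl u<u)
Strip-unique (skip _)         (skip _)         = refl , refl

Strip-Desc : ∀ {v b xs xs′} → Strip (suc v) b xs xs′ → Desc (suc v) xs → Desc v xs′
Strip-Desc s d with strip-view d
... | _ , _ , s′ , d′ with Strip-unique s s′
... | refl , refl = d′

Strip-from : ∀ {v} b {xs} → Desc v xs → ∃ λ ys → Strip (suc v) b ys xs × Desc (suc v) ys
Strip-from true  d = _ , strip , Desc-cons d
Strip-from false d = _ , skip (Desc-<suc d) , Desc-weaken d

Strip-∈⇔ : ∀ {u b xs xs′} → Strip u b xs xs′ → u ∈ xs ⇔ T b
Strip-∈⇔ strip       = mk⇔ (λ _ → tt) (λ _ → here refl)
Strip-∈⇔ (skip u>xs) = mk⇔ (λ m → <-irrefl refl (All.lookup u>xs m)) (λ ())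

Strip-⊆ : ∀ {u b xs xs′ w} → Strip u b xs xs′ → w ∈ xs′ → w ∈ xs
Strip-⊆ strip    m = there m
Strip-⊆ (skip _) m = m

Strip-∈⇔-≢ : ∀ {u b xs xs′ w} → Strip u b xs xs′ → w ≢ u → w ∈ xs ⇔ w ∈ xs′
Strip-∈⇔-≢ s w≢u = mk⇔ (forward s) (Strip-⊆ s)
  where
  forward : ∀ {b xs xs′} → Strip _ b xs xs′ → _ ∈ xs → _ ∈ xs′
  forward strip    (here refl) = ⊥-elim (w≢u refl)
  forward strip    (there m)   = m
  forward (skip _) m           = m

Strip-∈-below : ∀ {v b xs xs′ w} → Strip (suc v) b xs xs′ → w ≤ v → w ∈ xs → w ∈ xs′
Strip-∈-below s w≤v = to (Strip-∈⇔-≢ s λ w≡sv → <-irrefl w≡sv (s≤s w≤v))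

-- A value w with x_i < w ≤ y_i is only required to lie in G below x_{i-1}
-- (below p for i = 1); this lets consecutive gaps overlap, as for the
-- t_i < min(t_{i-1}, z_i) of a splitting and the c_i < c_{i+1} of maxcol.
GapsIn : (ℕ → Set) → Maybe ℕ → List ℕ → List ℕ → Set
GapsIn G p []       []       = ⊤
GapsIn G p (x ∷ xs) (y ∷ ys) = x ≤ y × (∀ w → x < w → w ≤ y → BelowN p w → G w) × GapsIn G (just x) xs ys
GapsIn G p []       (_ ∷ _)  = ⊥
GapsIn G p (_ ∷ _)  []       = ⊥

GapsIn-length : ∀ {G p} xs ys → GapsIn G p xs ys → length xs ≡ length ys
GapsIn-length []       []       _           = refl
GapsIn-length (_ ∷ xs) (_ ∷ ys) (_ , _ , g) = cong suc (GapsIn-length xs ys g)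

suc-if : Bool → ℕ → ℕ
suc-if false c = c
suc-if true  c = suc c

-- The counter c of the scan is the number of entries of ys above the current
-- value whose partner in xs has not been reached yet.
GapStep : (ℕ → Set) → ℕ → Bool → Bool → ℕ → ℕ → Set
GapStep G u true  inY c c′ = suc-if inY c ≡ suc c′
GapStep G u false inY c c′ = c′ ≡ suc-if inY c × (0 < c′ → G u)

data GapScan (G : ℕ → Set) : ℕ → ℕ → List ℕ → List ℕ → Set where
  done : GapScan G 0 0 [] []
  step : ∀ {v c c′ bx by xs xs′ ys ys′} →
         Strip (suc v) bx xs xs′ → Strip (suc v) by ys ys′ →
         GapStep G (suc v) bx by c c′ → GapScan G v c′ xs′ ys′ → GapScan G (suc v) c xs ys

private
  length-∷ʳ : ∀ (q : List ℕ) u → length (q ∷ʳ u) ≡ suc (length q)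
  length-∷ʳ q u = trans (length-++ q) (+-comm (length q) 1)

  BelowN-pred : ∀ p v → BelowN p (suc v) → BelowN p v
  BelowN-pred nothing  v _   = tt
  BelowN-pred (just u) v v<u = <-trans (n<1+n v) v<u

  All->-pred : ∀ {v q} → All (suc v <_) q → All (v <_) q
  All->-pred = All.map (<-trans (n<1+n _))

  gap-at : ∀ {G p v xs q₀ qs} → GapsIn G p xs (q₀ ∷ qs) → All (_< suc v) xs →
           suc v ≤ q₀ → BelowN p (suc v) → G (suc v)
  gap-at {xs = _ ∷ _} (_ , gap , _) (x<sv ∷ _) sv≤q₀ below = gap _ x<sv sv≤q₀ below

-- The list q holds the entries of ys above v still waiting for their partner.
gapsIn⇒gapScan′ : ∀ {G} v p q xs ys → Desc v xs → Desc v ys → All (v <_) q → BelowN p v →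
                  GapsIn G p xs (q ++ ys) → GapScan G v (length q) xs ys
gapsIn⇒gapScan′ zero p q xs ys dx dy _ _ g with Desc-zero dx | Desc-zero dy | q | g
... | refl | refl | []    | _ = done
... | refl | refl | _ ∷ _ | ()
gapsIn⇒gapScan′ {G} (suc v) p q xs ys dx dy q>v below g with strip-view dx | strip-view dy
... | true , xs′ , strip , dx′ | true , ys′ , strip , dy′ with q | g | q>v
...   | []     | (_ , _ , g′) | _ =
  step strip strip refl (gapsIn⇒gapScan′ v (just (suc v)) [] xs′ ys′ dx′ dy′ [] ≤-refl g′)
...   | _ ∷ qs | (_ , _ , g′) | _ ∷ qs>sv =
  step strip strip (cong suc (sym (length-∷ʳ qs (suc v))))
    (gapsIn⇒gapScan′ v (just (suc v)) (qs ∷ʳ suc v) xs′ ys′ dx′ dy′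
       (∷ʳ⁺ (All->-pred qs>sv) ≤-refl) ≤-refl
       (subst (GapsIn G (just (suc v)) xs′) (sym (∷ʳ-++ qs (suc v) ys′)) g′))
gapsIn⇒gapScan′ {G} (suc v) p q xs ys dx dy q>v below g
  | true , xs′ , strip , dx′ | false , ys′ , skip ys<sv , dy′ with q | g | q>v
... | []     | g | _ = ⊥-elim (unpaired ys g ys<sv)
  where
  unpaired : ∀ ys → GapsIn G p (suc v ∷ xs′) ys → All (_< suc v) ys → ⊥
  unpaired (_ ∷ _) (sv≤y , _) (y<sv ∷ _) = <-irrefl refl (≤-trans y<sv sv≤y)
... | _ ∷ qs | (_ , _ , g′) | _ ∷ qs>sv =
  step strip (skip ys<sv) refl
    (gapsIn⇒gapScan′ v (just (suc v)) qs xs′ ys′ dx′ dy′ (All->-pred qs>sv) ≤-refl g′)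
gapsIn⇒gapScan′ {G} (suc v) p q xs ys dx dy q>v below g
  | false , xs′ , skip xs<sv , dx′ | true , ys′ , strip , dy′ =
  step (skip xs<sv) strip (length-∷ʳ q (suc v) , λ _ → gap q g q>v)
    (gapsIn⇒gapScan′ v p (q ∷ʳ suc v) xs ys′ dx′ dy′
       (∷ʳ⁺ (All->-pred q>v) ≤-refl) (BelowN-pred p v below)
       (subst (GapsIn G p xs) (sym (∷ʳ-++ q (suc v) ys′)) g))
  where
  gap : ∀ q → GapsIn G p xs (q ++ suc v ∷ ys′) → All (suc v <_) q → G (suc v)
  gap []      g _            = gap-at g xs<sv ≤-refl below
  gap (_ ∷ _) g (sv<q₀ ∷ _) = gap-at g xs<sv (<⇒≤ sv<q₀) below
gapsIn⇒gapScan′ {G} (suc v) p q xs ys dx dy q>v below g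
  | false , xs′ , skip xs<sv , dx′ | false , ys′ , skip ys<sv , dy′ =
  step (skip xs<sv) (skip ys<sv) (refl , gap q g q>v)
    (gapsIn⇒gapScan′ v p q xs ys dx′ dy′ (All->-pred q>v) (BelowN-pred p v below) g)
  where
  gap : ∀ q → GapsIn G p xs (q ++ ys) → All (suc v <_) q → 0 < length q → G (suc v)
  gap (_ ∷ _) g (sv<q₀ ∷ _) _ = gap-at g xs<sv (<⇒≤ sv<q₀) below

gapsIn⇒gapScan : ∀ {G v xs ys} → Desc v xs → Desc v ys → GapsIn G nothing xs ys → GapScan G v 0 xs ys
gapsIn⇒gapScan {v = v} {xs} {ys} dx dy = gapsIn⇒gapScan′ v nothing [] xs ys dx dy [] tt

-- The gap of the first pending entry has been verified down to v.
GapSoFar : (ℕ → Set) → ℕ → Maybe ℕ → List ℕ → Set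
GapSoFar G v p []      = ⊤
GapSoFar G v p (q₀ ∷ _) = ∀ w → v < w → w ≤ q₀ → BelowN p w → G w

private
  GapSoFar-fresh : ∀ {G v} q → GapSoFar G v (just (suc v)) q
  GapSoFar-fresh []      = tt
  GapSoFar-fresh (_ ∷ _) w v<w _ w<sv = ⊥-elim (<-irrefl refl (≤-trans w<sv v<w))

  GapSoFar-lower : ∀ {G v p} q → G (suc v) → GapSoFar G (suc v) p q → GapSoFar G v p q
  GapSoFar-lower []      _ _ = tt
  GapSoFar-lower {v = v} (_ ∷ _) g old w v<w w≤q₀ below with w ≟ suc v
  ... | yes refl = g
  ... | no w≢sv  = old w (≤∧≢⇒< v<w (w≢sv ∘ sym)) w≤q₀ below

  GapSoFar-step : ∀ {G v p c} q → length q ≡ c → (0 < c → G (suc v)) →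
                  GapSoFar G (suc v) p q → GapSoFar G v p q
  GapSoFar-step []        _    _ _   = tt
  GapSoFar-step (q₀ ∷ qs) refl g old = GapSoFar-lower (q₀ ∷ qs) (g (s≤s z≤n)) old

  GapSoFar-extend : ∀ {G v p} q → G (suc v) → GapSoFar G (suc v) p q → GapSoFar G v p (q ∷ʳ suc v)
  GapSoFar-extend []      g _ w v<w w≤sv _ rewrite ≤-antisym w≤sv v<w = g
  GapSoFar-extend (q₀ ∷ qs) g old = GapSoFar-lower (q₀ ∷ qs) g old

gapScan⇒gapsIn′ : ∀ {G v c p q xs ys} → GapScan G v c xs ys → length q ≡ c → All (v <_) q →
                  GapSoFar G v p q → GapsIn G p xs (q ++ ys)
gapScan⇒gapsIn′ {q = []}    done _  _ _ = tt
gapScan⇒gapsIn′ {G} {suc v} {q = []} (step strip strip refl scan) refl _ _ =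
  ≤-refl , (λ w sv<w w≤sv _ → ⊥-elim (<-irrefl refl (≤-trans sv<w w≤sv))) ,
  gapScan⇒gapsIn′ scan refl [] tt
gapScan⇒gapsIn′ {G} {suc v} {q = q₀ ∷ qs} (step {xs′ = xs′} {ys′ = ys′} strip strip st scan) lq (sv<q₀ ∷ qs>sv) gap =
  <⇒≤ sv<q₀ , gap ,
  subst (GapsIn G (just (suc v)) xs′) (∷ʳ-++ qs (suc v) ys′)
    (gapScan⇒gapsIn′ scan (trans (length-∷ʳ qs (suc v)) (suc-injective (trans (cong suc lq) st)))
       (∷ʳ⁺ (All->-pred qs>sv) ≤-refl) (GapSoFar-fresh (qs ∷ʳ suc v)))
gapScan⇒gapsIn′ {G} {suc v} {q = []} (step strip (skip _) () scan) refl _ _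
gapScan⇒gapsIn′ {G} {suc v} {q = _ ∷ qs} (step strip (skip _) st scan) lq (sv<q₀ ∷ qs>sv) gap =
  <⇒≤ sv<q₀ , gap , gapScan⇒gapsIn′ scan (suc-injective (trans lq st)) (All->-pred qs>sv) (GapSoFar-fresh qs)
gapScan⇒gapsIn′ {G} {suc v} {p = p} {q} {xs} (step {ys′ = ys′} (skip _) strip (c′≡ , g) scan) lq q>sv gap =
  subst (GapsIn G p xs) (∷ʳ-++ q (suc v) ys′)
    (gapScan⇒gapsIn′ scan (trans (length-∷ʳ q (suc v)) (trans (cong suc lq) (sym c′≡)))
       (∷ʳ⁺ (All->-pred q>sv) ≤-refl)
       (GapSoFar-extend q (g (subst (0 <_) (sym c′≡) (s≤s z≤n))) gap))
gapScan⇒gapsIn′ {G} {suc v} {q = q} (step (skip _) (skip _) (c′≡ , g) scan) lq q>sv gap =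
  gapScan⇒gapsIn′ scan (trans lq (sym c′≡)) (All->-pred q>sv)
    (GapSoFar-step q (trans lq (sym c′≡)) g gap)

gapScan⇒gapsIn : ∀ {G v xs ys} → GapScan G v 0 xs ys → GapsIn G nothing xs ys
gapScan⇒gapsIn scan = gapScan⇒gapsIn′ {q = []} scan refl [] tt

Congruent : (Set → Set → Set → Set → Set) → Set₁
Congruent Φ = ∀ {A B C D A′ B′ C′ D′} → A ⇔ A′ → B ⇔ B′ → C ⇔ C′ → D ⇔ D′ →
              Φ A B C D → Φ A′ B′ C′ D′

Valuewise : (Set → Set → Set → Set → Set) → List ℕ → List ℕ → List ℕ → List ℕ → Set
Valuewise Φ x₁ x₂ x₃ x₄ = ∀ w → Φ (w ∈ x₁) (w ∈ x₂) (w ∈ x₃) (w ∈ x₄)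

module _ {Φ} (Φ-cong : Congruent Φ) {u b₁ b₂ b₃ b₄ x₁ x₂ x₃ x₄ y₁ y₂ y₃ y₄}
         (s₁ : Strip u b₁ x₁ y₁) (s₂ : Strip u b₂ x₂ y₂)
         (s₃ : Strip u b₃ x₃ y₃) (s₄ : Strip u b₄ x₄ y₄) where

  Valuewise-head : Valuewise Φ x₁ x₂ x₃ x₄ → Φ (T b₁) (T b₂) (T b₃) (T b₄)
  Valuewise-head φ = Φ-cong (Strip-∈⇔ s₁) (Strip-∈⇔ s₂) (Strip-∈⇔ s₃) (Strip-∈⇔ s₄) (φ u)

  Valuewise-cons : Φ (T b₁) (T b₂) (T b₃) (T b₄) → Valuewise Φ y₁ y₂ y₃ y₄ → Valuewise Φ x₁ x₂ x₃ x₄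
  Valuewise-cons φu φ w with w ≟ u
  ... | yes refl = Φ-cong (⇔-sym (Strip-∈⇔ s₁)) (⇔-sym (Strip-∈⇔ s₂))
                          (⇔-sym (Strip-∈⇔ s₃)) (⇔-sym (Strip-∈⇔ s₄)) φu
  ... | no w≢u   = Φ-cong (⇔-sym (Strip-∈⇔-≢ s₁ w≢u)) (⇔-sym (Strip-∈⇔-≢ s₂ w≢u))
                          (⇔-sym (Strip-∈⇔-≢ s₃ w≢u)) (⇔-sym (Strip-∈⇔-≢ s₄ w≢u)) (φ w)

module _ {Φ} (Φ-cong : Congruent Φ) (Φ-∅ : Φ ⊥ ⊥ ⊥ ⊥) {v b₁ b₂ b₃ b₄ x₁ x₂ x₃ x₄ y₁ y₂ y₃ y₄}
         (s₁ : Strip (suc v) b₁ x₁ y₁) (s₂ : Strip (suc v) b₂ x₂ y₂)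
         (s₃ : Strip (suc v) b₃ x₃ y₃) (s₄ : Strip (suc v) b₄ x₄ y₄) where

  Valuewise-tail : Desc v y₁ → Desc v y₂ → Desc v y₃ → Desc v y₄ →
                   Valuewise Φ x₁ x₂ x₃ x₄ → Valuewise Φ y₁ y₂ y₃ y₄
  Valuewise-tail d₁ d₂ d₃ d₄ φ w with w ≟ suc v
  ... | yes refl = Φ-cong (absent d₁) (absent d₂) (absent d₃) (absent d₄) Φ-∅
    where absent : ∀ {ys} → Desc v ys → ⊥ ⇔ suc v ∈ ys
          absent d = mk⇔ ⊥-elim (Desc-∉ d)
  ... | no w≢sv  = Φ-cong (Strip-∈⇔-≢ s₁ w≢sv) (Strip-∈⇔-≢ s₂ w≢sv)
                          (Strip-∈⇔-≢ s₃ w≢sv) (Strip-∈⇔-≢ s₄ w≢sv) (φ w)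

Disjoint-strip : ∀ {u bx by x x′ y y′} → Strip u bx x x′ → Strip u by y y′ → Disjoint x y → Disjoint x′ y′
Disjoint-strip sx sy d (m₁ , m₂) = d (Strip-⊆ sx m₁ , Strip-⊆ sy m₂)

Disjoint-head : ∀ {u bx by x x′ y y′} → Strip u bx x x′ → Strip u by y y′ → Disjoint x y → ¬ (T bx × T by)
Disjoint-head sx sy d (tx , ty) = d (from (Strip-∈⇔ sx) tx , from (Strip-∈⇔ sy) ty)

-- Bracket words

-- The memberships a value may have in (A, A′, B, B′), where A, A′ hold the
-- unbarred values and B, B′ the absolute values of the barred entries of D, D′.
-- A value of A′ ∩ B opens a bracket and one of A ∩ B′ closes one.
data Shape : Bool → Bool → Bool → Bool → Set where
  absent   : Shape false false false false
  opens    : Shape false true  true  false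
  closes   : Shape true  false false true
  unbarred : Shape true  true  false false
  barred   : Shape false false true  true

Count : ∀ {ba ba′ bb bb′} → Shape ba ba′ bb bb′ → ℕ → ℕ → Set
Count absent   c c′ = c ≡ 0 × c′ ≡ 0
Count opens    c c′ = c′ ≡ suc c
Count closes   c c′ = c ≡ suc c′
Count unbarred c c′ = c′ ≡ c
Count barred   c c′ = c′ ≡ c

data Word : ℕ → ℕ → List ℕ → List ℕ → List ℕ → List ℕ → Set where
  done : Word 0 0 [] [] [] []
  step : ∀ {v c c′ ba ba′ bb bb′ a a₁ a′ a₁′ b b₁ b′ b₁′} →
         Strip (suc v) ba a a₁ → Strip (suc v) ba′ a′ a₁′ → Strip (suc v) bb b b₁ → Strip (suc v) bb′ b′ b₁′ →
         (s : Shape ba ba′ bb bb′) → Count s c c′ → Word v c′ a₁ a₁′ b₁ b₁′ → Word (suc v) c a a′ b b′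

SameValues : Set → Set → Set → Set → Set
SameValues A A′ B B′ = (A ⊎ B) ⇔ (A′ ⊎ B′)

SameValues-cong : Congruent SameValues
SameValues-cong a a′ b b′ r = ⇔-trans (⇔-sym (a ⊎-⇔ b)) (⇔-trans r (a′ ⊎-⇔ b′))

SameValues-shape : ∀ {ba ba′ bb bb′} → Shape ba ba′ bb bb′ → SameValues (T ba) (T ba′) (T bb) (T bb′)
SameValues-shape absent   = mk⇔ (λ { (inj₁ ()) ; (inj₂ ()) }) (λ { (inj₁ ()) ; (inj₂ ()) })
SameValues-shape opens    = mk⇔ (λ _ → inj₁ tt) (λ _ → inj₂ tt)
SameValues-shape closes   = mk⇔ (λ _ → inj₂ tt) (λ _ → inj₁ tt)
SameValues-shape unbarred = mk⇔ (λ _ → inj₁ tt) (λ _ → inj₁ tt)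
SameValues-shape barred   = mk⇔ (λ _ → inj₂ tt) (λ _ → inj₂ tt)

shape-from-SameValues : ∀ ba ba′ bb bb′ → ¬ (T ba × T bb) → ¬ (T ba′ × T bb′) →
                        SameValues (T ba) (T ba′) (T bb) (T bb′) → Shape ba ba′ bb bb′
shape-from-SameValues false false false false _ _ _ = absent
shape-from-SameValues false true  true  false _ _ _ = opens
shape-from-SameValues true  false false true  _ _ _ = closes
shape-from-SameValues true  true  false false _ _ _ = unbarred
shape-from-SameValues false false true  true  _ _ _ = barred
shape-from-SameValues true  _     true  _     d _ _ = ⊥-elim (d (tt , tt))
shape-from-SameValues _     true  _     true  _ d _ = ⊥-elim (d (tt , tt))
shape-from-SameValues false false false true  _ _ r with from r (inj₂ tt)
... | inj₁ ()
... | inj₂ ()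
shape-from-SameValues false false true  false _ _ r with to r (inj₂ tt)
... | inj₁ ()
... | inj₂ ()
shape-from-SameValues false true  false false _ _ r with from r (inj₁ tt)
... | inj₁ ()
... | inj₂ ()
shape-from-SameValues true  false false false _ _ r with to r (inj₁ tt)
... | inj₁ ()
... | inj₂ ()

SameValues-∅ : SameValues ⊥ ⊥ ⊥ ⊥
SameValues-∅ = mk⇔ [ ⊥-elim , ⊥-elim ] [ ⊥-elim , ⊥-elim ]

gapStep-unbarred : ∀ {G u ba ba′ bb bb′ c c′} (s : Shape ba ba′ bb bb′) → Count s c c′ →
                   (T bb → G u) → GapStep G u ba ba′ c c′
gapStep-unbarred absent   (refl , refl) _ = refl , λ ()
gapStep-unbarred opens    c′≡           g = c′≡ , λ _ → g tt
gapStep-unbarred closes   c≡            _ = c≡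
gapStep-unbarred unbarred c′≡           _ = cong suc (sym c′≡)
gapStep-unbarred barred   c′≡           g = c′≡ , λ _ → g tt

gapStep-barred : ∀ {G u ba ba′ bb bb′ c c′} (s : Shape ba ba′ bb bb′) → Count s c c′ →
                 (T ba′ → G u) → GapStep G u bb′ bb c c′
gapStep-barred absent   (refl , refl) _ = refl , λ ()
gapStep-barred opens    c′≡           g = c′≡ , λ _ → g tt
gapStep-barred closes   c≡            _ = c≡
gapStep-barred unbarred c′≡           g = c′≡ , λ _ → g tt
gapStep-barred barred   c′≡           _ = cong suc (sym c′≡)

count-from-gapSteps : ∀ {H u ba ba′ bb bb′ c c₁ c₂} (s : Shape ba ba′ bb bb′) →
                      GapStep H u ba ba′ c c₁ → GapStep H u bb′ bb c c₂ → (H u → T ba ⊎ T bb) →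
                      Count s c c₁ × c₂ ≡ c₁
count-from-gapSteps {c₁ = zero}  absent (c₁≡ , _) (c₂≡ , _) _ = (sym c₁≡ , refl) , trans c₂≡ (sym c₁≡)
count-from-gapSteps {c₁ = suc _} absent (_ , g) _ h with h (g (s≤s z≤n))
... | inj₁ ()
... | inj₂ ()
count-from-gapSteps opens    (c₁≡ , _) (c₂≡ , _) _ = c₁≡ , trans c₂≡ (sym c₁≡)
count-from-gapSteps closes   c≡₁       c≡₂       _ = c≡₁ , suc-injective (trans (sym c≡₂) c≡₁)
count-from-gapSteps unbarred sc≡       (c₂≡ , _) _ = suc-injective (sym sc≡) , trans c₂≡ (suc-injective sc≡)
count-from-gapSteps barred   (c₁≡ , _) sc≡       _ = c₁≡ , trans (sym (suc-injective sc≡)) (sym c₁≡)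

word⇒gaps-R1 : ∀ {H v c a a′ b b′} → Word v c a a′ b b′ → (∀ {w} → w ∈ a → H w) → (∀ {w} → w ∈ b → H w) →
               GapScan H v c a a′ × GapScan H v c b′ b × Valuewise SameValues a a′ b b′
word⇒gaps-R1 done _ _ = done , done , λ _ → mk⇔ [ (λ ()) , (λ ()) ] [ (λ ()) , (λ ()) ]
word⇒gaps-R1 (step sa sa′ sb sb′ s count word) ha hb
  with word⇒gaps-R1 word (λ m → ha (Strip-⊆ sa m)) (λ m → hb (Strip-⊆ sb m))
... | ga , gb , same =
  step sa sa′ (gapStep-unbarred s count (λ t → hb (from (Strip-∈⇔ sb) t))) ga ,
  step sb′ sb (gapStep-barred s count (λ t → H-at (from (SameValues-shape s) (inj₁ t)))) gb ,
  Valuewise-cons SameValues-cong sa sa′ sb sb′ (SameValues-shape s) same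
  where
  H-at = [ (λ t → ha (from (Strip-∈⇔ sa) t)) , (λ t → hb (from (Strip-∈⇔ sb) t)) ]

gaps-R1⇒word : ∀ {H v c a a′ b b′} → GapScan H v c a a′ → GapScan H v c b′ b → Valuewise SameValues a a′ b b′ →
               Disjoint a b → Disjoint a′ b′ → (∀ w → w ≤ v → H w → w ∈ a ⊎ w ∈ b) →
               Desc v a → Desc v a′ → Desc v b → Desc v b′ → Word v c a a′ b b′
gaps-R1⇒word done done _ _ _ _ _ _ _ _ = done
gaps-R1⇒word {H} {suc v} (step {bx = ba} {by = ba′} sa sa′ sta ga) (step {bx = bb′} {by = bb} sb′ sb stb gb)
             same d d′ covered da da′ db db′
  with shape-from-SameValues ba ba′ bb bb′ (Disjoint-head sa sb d) (Disjoint-head sa′ sb′ d′)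
         (Valuewise-head SameValues-cong sa sa′ sb sb′ same)
... | s with count-from-gapSteps s sta stb
              (λ h → Sum.map (to (Strip-∈⇔ sa)) (to (Strip-∈⇔ sb)) (covered (suc v) ≤-refl h))
... | count , refl =
  step sa sa′ sb sb′ s count
    (gaps-R1⇒word ga gb (Valuewise-tail SameValues-cong SameValues-∅ sa sa′ sb sb′ da₁ da₁′ db₁ db₁′ same)
       (Disjoint-strip sa sb d) (Disjoint-strip sa′ sb′ d′) covered′ da₁ da₁′ db₁ db₁′)
  where
  da₁ = Strip-Desc sa da
  da₁′ = Strip-Desc sa′ da′
  db₁ = Strip-Desc sb db
  db₁′ = Strip-Desc sb′ db′
  covered′ : ∀ w → w ≤ v → H w → _ ⊎ _
  covered′ w w≤v h = Sum.map (Strip-∈-below sa w≤v) (Strip-∈-below sb w≤v) (covered w (m≤n⇒m≤1+n w≤v) h)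

UnbarredRule : Set → Set → Set → Set → Set
UnbarredRule A A′ B B′ = A ⇔ ((A′ ⊎ B′) × ¬ B)

UnbarredRule-cong : Congruent UnbarredRule
UnbarredRule-cong a a′ b b′ r = ⇔-trans (⇔-sym a) (⇔-trans r ((a′ ⊎-⇔ b′) ×-⇔ ¬-cong-⇔ b))

UnbarredRule-∅ : UnbarredRule ⊥ ⊥ ⊥ ⊥
UnbarredRule-∅ = mk⇔ ⊥-elim λ { (inj₁ () , _) ; (inj₂ () , _) }

UnbarredRule-shape : ∀ {ba ba′ bb bb′} → Shape ba ba′ bb bb′ → UnbarredRule (T ba) (T ba′) (T bb) (T bb′)
UnbarredRule-shape absent   = mk⇔ (λ ()) λ { (inj₁ () , _) ; (inj₂ () , _) }
UnbarredRule-shape opens    = mk⇔ (λ ()) λ { (_ , ∉b) → ∉b tt }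
UnbarredRule-shape closes   = mk⇔ (λ _ → inj₂ tt , λ ()) (λ _ → tt)
UnbarredRule-shape unbarred = mk⇔ (λ _ → inj₁ tt , λ ()) (λ _ → tt)
UnbarredRule-shape barred   = mk⇔ (λ ()) λ { (_ , ∉b) → ∉b tt }

-- Besides the five shapes, Condition (2) allows a value lying in B alone; the
-- maxcol condition rules it out.
data Shape⁺ : Bool → Bool → Bool → Bool → Set where
  shape      : ∀ {ba ba′ bb bb′} → Shape ba ba′ bb bb′ → Shape⁺ ba ba′ bb bb′
  barredOnly : Shape⁺ false false true false

shape-from-UnbarredRule : ∀ ba ba′ bb bb′ → ¬ (T ba × T bb) → ¬ (T ba′ × T bb′) →
                          UnbarredRule (T ba) (T ba′) (T bb) (T bb′) → Shape⁺ ba ba′ bb bb′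
shape-from-UnbarredRule true  _     true  _     d _ _ = ⊥-elim (d (tt , tt))
shape-from-UnbarredRule _     true  _     true  _ d _ = ⊥-elim (d (tt , tt))
shape-from-UnbarredRule false false true  false _ _ _ = barredOnly
shape-from-UnbarredRule false true  true  false _ _ _ = shape opens
shape-from-UnbarredRule false false true  true  _ _ _ = shape barred
shape-from-UnbarredRule false false false false _ _ _ = shape absent
shape-from-UnbarredRule true  true  false false _ _ _ = shape unbarred
shape-from-UnbarredRule true  false false true  _ _ _ = shape closes
shape-from-UnbarredRule false true  false false _ _ r = ⊥-elim (from r (inj₁ tt , λ ()))
shape-from-UnbarredRule false false false true  _ _ r = ⊥-elim (from r (inj₂ tt , λ ()))
shape-from-UnbarredRule true  false false false _ _ r with to r tt
... | inj₁ () , _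
... | inj₂ () , _

word⇒gaps-UnbarredRule : ∀ {G v c a a′ b b′} → Word v c a a′ b b′ → (∀ {w} → w ∈ a′ → G w) →
                         GapScan G v c b′ b × Valuewise UnbarredRule a a′ b b′
word⇒gaps-UnbarredRule done _ = done , λ _ → mk⇔ (λ ()) λ { (inj₁ () , _) ; (inj₂ () , _) }
word⇒gaps-UnbarredRule (step sa sa′ sb sb′ s count word) ga
  with word⇒gaps-UnbarredRule word (λ m → ga (Strip-⊆ sa′ m))
... | gb , rule =
  step sb′ sb (gapStep-barred s count (λ t → ga (from (Strip-∈⇔ sa′) t))) gb ,
  Valuewise-cons UnbarredRule-cong sa sa′ sb sb′ (UnbarredRule-shape s) rule

count-from-barredGapStep : ∀ {G u ba ba′ bb bb′ c c′} → Shape⁺ ba ba′ bb bb′ →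
                           GapStep G u bb′ bb c c′ → (G u → T ba′) →
                           Σ (Shape ba ba′ bb bb′) λ s → Count s c c′
count-from-barredGapStep {c′ = zero}  (shape absent) (c′≡ , _) _ = absent , sym c′≡ , refl
count-from-barredGapStep {c′ = suc _} (shape absent) (_ , g) h with h (g (s≤s z≤n))
... | ()
count-from-barredGapStep (shape opens)    (c′≡ , _) _ = opens , c′≡
count-from-barredGapStep (shape closes)   c≡        _ = closes , c≡
count-from-barredGapStep (shape unbarred) (c′≡ , _) _ = unbarred , c′≡
count-from-barredGapStep (shape barred)   sc≡       _ = barred , suc-injective (sym sc≡)
count-from-barredGapStep barredOnly       (c′≡ , g) h with h (g (subst (0 <_) (sym c′≡) (s≤s z≤n)))
... | ()

gaps-UnbarredRule⇒word : ∀ {G v c a a′ b b′} → GapScan G v c b′ b → Valuewise UnbarredRule a a′ b b′ →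
                         Disjoint a b → Disjoint a′ b′ → (∀ w → w ≤ v → G w → w ∈ a′) →
                         Desc v a → Desc v a′ → Desc v b → Desc v b′ → Word v c a a′ b b′
gaps-UnbarredRule⇒word done _ _ _ _ da da′ _ _ rewrite Desc-zero da | Desc-zero da′ = done
gaps-UnbarredRule⇒word {G} {suc v} (step {bx = bb′} {by = bb} sb′ sb stb gb) rule d d′ covered da da′ db db′
  with strip-view da | strip-view da′
... | ba , a₁ , sa , da₁ | ba′ , a₁′ , sa′ , da₁′
  with count-from-barredGapStep
         (shape-from-UnbarredRule ba ba′ bb bb′ (Disjoint-head sa sb d) (Disjoint-head sa′ sb′ d′)
            (Valuewise-head UnbarredRule-cong sa sa′ sb sb′ rule))
         stb (λ g → to (Strip-∈⇔ sa′) (covered (suc v) ≤-refl g))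
... | s , count =
  step sa sa′ sb sb′ s count
    (gaps-UnbarredRule⇒word gb
       (Valuewise-tail UnbarredRule-cong UnbarredRule-∅ sa sa′ sb sb′ da₁ da₁′ db₁ db₁′ rule)
       (Disjoint-strip sa sb d) (Disjoint-strip sa′ sb′ d′) covered′ da₁ da₁′ db₁ db₁′)
  where
  db₁ = Strip-Desc sb db
  db₁′ = Strip-Desc sb′ db′
  covered′ : ∀ w → w ≤ v → G w → w ∈ a₁′
  covered′ w w≤v g = Strip-∈-below sa′ w≤v (covered w (m≤n⇒m≤1+n w≤v) g)

-- For E with E₊ = A′ and E₋ = B: the z_i are the values in both, the t_i are free.
SplitValues : Set → Set → Set → Set → Set
SplitValues Z T A′ B = (Z ⇔ (A′ × B)) × (T → ¬ A′ × ¬ B)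

-- X is Y with the z_i replaced by the t_i.
Replaced : Set → Set → Set → Set → Set
Replaced X Y Z T = X ⇔ ((Y × ¬ Z) ⊎ T)

SplitValues-cong : Congruent SplitValues
SplitValues-cong z t a′ b (paired , free) =
  ⇔-trans (⇔-sym z) (⇔-trans paired (a′ ×-⇔ b)) ,
  λ t′ → let ¬a′ , ¬b = free (from t t′) in (λ m → ¬a′ (from a′ m)) , (λ m → ¬b (from b m))

SplitValues-∅ : SplitValues ⊥ ⊥ ⊥ ⊥
SplitValues-∅ = mk⇔ ⊥-elim (λ ()) , λ ()

Replaced-cong : Congruent Replaced
Replaced-cong x y z t r = ⇔-trans (⇔-sym x) (⇔-trans r ((y ×-⇔ ¬-cong-⇔ z) ⊎-⇔ t))

Replaced-∅ : Replaced ⊥ ⊥ ⊥ ⊥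
Replaced-∅ = mk⇔ ⊥-elim λ { (inj₁ (() , _)) ; (inj₂ ()) }

opening closing : ∀ {ba ba′ bb bb′} → Shape ba ba′ bb bb′ → Bool
opening opens = true
opening _     = false
closing closes = true
closing _      = false

-- A shape together with whether the value is a z_i (opening) or a t_i (closing).
data SplitShape : Bool → Bool → Bool → Bool → Bool → Bool → Set where
  split : ∀ {ba ba′ bb bb′} (s : Shape ba ba′ bb bb′) → SplitShape ba ba′ bb bb′ (opening s) (closing s)

SplitValues-shape : ∀ {ba ba′ bb bb′} (s : Shape ba ba′ bb bb′) →
                    SplitValues (T (opening s)) (T (closing s)) (T ba′) (T bb)
SplitValues-shape absent   = mk⇔ (λ ()) (λ { (() , _) }) , λ ()
SplitValues-shape opens    = mk⇔ (λ _ → tt , tt) (λ _ → tt) , λ ()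
SplitValues-shape closes   = mk⇔ (λ ()) (λ { (() , _) }) , λ _ → (λ ()) , (λ ())
SplitValues-shape unbarred = mk⇔ (λ ()) (λ { (_ , ()) }) , λ ()
SplitValues-shape barred   = mk⇔ (λ ()) (λ { (() , _) }) , λ ()

Replaced-barred : ∀ {ba ba′ bb bb′} (s : Shape ba ba′ bb bb′) →
                  Replaced (T bb′) (T bb) (T (opening s)) (T (closing s))
Replaced-barred absent   = mk⇔ (λ ()) λ { (inj₁ (() , _)) ; (inj₂ ()) }
Replaced-barred opens    = mk⇔ (λ ()) λ { (inj₁ (_ , ¬z)) → ¬z tt ; (inj₂ ()) }
Replaced-barred closes   = mk⇔ (λ _ → inj₂ tt) (λ _ → tt)
Replaced-barred unbarred = mk⇔ (λ ()) λ { (inj₁ (() , _)) ; (inj₂ ()) }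
Replaced-barred barred   = mk⇔ (λ _ → inj₁ (tt , λ ())) (λ _ → tt)

Replaced-unbarred : ∀ {ba ba′ bb bb′} (s : Shape ba ba′ bb bb′) →
                    Replaced (T ba) (T ba′) (T (opening s)) (T (closing s))
Replaced-unbarred absent   = mk⇔ (λ ()) λ { (inj₁ (() , _)) ; (inj₂ ()) }
Replaced-unbarred opens    = mk⇔ (λ ()) λ { (inj₁ (_ , ¬z)) → ¬z tt ; (inj₂ ()) }
Replaced-unbarred closes   = mk⇔ (λ _ → inj₂ tt) (λ _ → tt)
Replaced-unbarred unbarred = mk⇔ (λ _ → inj₁ (tt , λ ())) (λ _ → tt)
Replaced-unbarred barred   = mk⇔ (λ ()) λ { (inj₁ (() , _)) ; (inj₂ ()) }

gapStep-split : ∀ {G u ba ba′ bb bb′ c c′} (s : Shape ba ba′ bb bb′) → Count s c c′ →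
                (T ba′ → G u) → (T bb → G u) → GapStep G u (closing s) (opening s) c c′
gapStep-split absent   (refl , refl) _  _  = refl , λ ()
gapStep-split opens    c′≡           ga _  = c′≡ , λ _ → ga tt
gapStep-split closes   c≡            _  _  = c≡
gapStep-split unbarred c′≡           ga _  = c′≡ , λ _ → ga tt
gapStep-split barred   c′≡           _  gb = c′≡ , λ _ → gb tt

private
  T⇔⇒true : ∀ {x} {P : Set} → T x ⇔ P → P → x ≡ true
  T⇔⇒true {true}  _ _ = refl
  T⇔⇒true {false} r p = ⊥-elim (from r p)

  T⇔⇒false : ∀ {x} {P : Set} → T x ⇔ P → ¬ P → x ≡ false
  T⇔⇒false {true}  r ¬p = ⊥-elim (¬p (to r tt))
  T⇔⇒false {false} _ _  = refl

splitShape-from : ∀ ba ba′ bb bb′ bz bt → SplitValues (T bz) (T bt) (T ba′) (T bb) →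
                  Replaced (T bb′) (T bb) (T bz) (T bt) → Replaced (T ba) (T ba′) (T bz) (T bt) →
                  SplitShape ba ba′ bb bb′ bz bt
splitShape-from _ true  _    _ _ true (_ , free) _ _ = ⊥-elim (proj₁ (free tt) tt)
splitShape-from _ false true _ _ true (_ , free) _ _ = ⊥-elim (proj₂ (free tt) tt)
splitShape-from _ true true _ _ false (paired , _) rb ra
  with T⇔⇒true paired (tt , tt)
... | refl with T⇔⇒false rb (λ { (inj₁ (_ , ¬z)) → ¬z tt ; (inj₂ ()) })
              | T⇔⇒false ra (λ { (inj₁ (_ , ¬z)) → ¬z tt ; (inj₂ ()) })
... | refl | refl = split opens
splitShape-from _ true false _ _ false (paired , _) rb ra
  with T⇔⇒false paired (λ { (_ , ()) })
... | refl with T⇔⇒false rb (λ { (inj₁ (() , _)) ; (inj₂ ()) }) | T⇔⇒true ra (inj₁ (tt , λ ()))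
... | refl | refl = split unbarred
splitShape-from _ false true _ _ false (paired , _) rb ra
  with T⇔⇒false paired (λ { (() , _) })
... | refl with T⇔⇒true rb (inj₁ (tt , λ ())) | T⇔⇒false ra (λ { (inj₁ (() , _)) ; (inj₂ ()) })
... | refl | refl = split barred
splitShape-from _ false false _ _ false (paired , _) rb ra
  with T⇔⇒false paired (λ { (() , _) })
... | refl with T⇔⇒false rb (λ { (inj₁ (() , _)) ; (inj₂ ()) }) | T⇔⇒false ra (λ { (inj₁ (() , _)) ; (inj₂ ()) })
... | refl | refl = split absent
splitShape-from _ false false _ _ true (paired , _) rb ra
  with T⇔⇒false paired (λ { (() , _) })
... | refl with T⇔⇒true rb (inj₂ tt) | T⇔⇒true ra (inj₂ tt)
... | refl | refl = split closes

count-from-splitGapStep : ∀ {G u ba ba′ bb bb′ c c′} (s : Shape ba ba′ bb bb′) →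
                          GapStep G u (closing s) (opening s) c c′ → (G u → T ba′ ⊎ T bb) → Count s c c′
count-from-splitGapStep {c′ = zero}  absent   (c′≡ , _) _ = sym c′≡ , refl
count-from-splitGapStep {c′ = suc _} absent   (_ , g)   h with h (g (s≤s z≤n))
... | inj₁ ()
... | inj₂ ()
count-from-splitGapStep              opens    (c′≡ , _) _ = c′≡
count-from-splitGapStep              closes   c≡        _ = c≡
count-from-splitGapStep              unbarred (c′≡ , _) _ = c′≡
count-from-splitGapStep              barred   (c′≡ , _) _ = c′≡

record ScanSplitting (G : ℕ → Set) (v c : ℕ) (a a′ b b′ : List ℕ) : Set where
  constructor scanSplitting
  field
    zs ts             : List ℕ
    zs-desc           : Desc v zs
    ts-desc           : Desc v ts
    gaps              : GapScan G v c ts zs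
    paired            : Valuewise SplitValues zs ts a′ b
    barred-replaced   : Valuewise Replaced b′ b zs ts
    unbarred-replaced : Valuewise Replaced a a′ zs ts

word⇒scanSplitting : ∀ {G v c a a′ b b′} → Word v c a a′ b b′ → (∀ {w} → w ∈ a′ → G w) →
                     (∀ {w} → w ∈ b → G w) → ScanSplitting G v c a a′ b b′
word⇒scanSplitting done _ _ = record
  { zs = [] ; ts = [] ; zs-desc = [] , [] ; ts-desc = [] , [] ; gaps = done
  ; paired            = λ _ → mk⇔ (λ ()) (λ { (() , _) }) , λ ()
  ; barred-replaced   = λ _ → mk⇔ (λ ()) λ { (inj₁ (() , _)) ; (inj₂ ()) }
  ; unbarred-replaced = λ _ → mk⇔ (λ ()) λ { (inj₁ (() , _)) ; (inj₂ ()) } }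
word⇒scanSplitting (step sa sa′ sb sb′ s count word) ga gb
  with word⇒scanSplitting word (λ m → ga (Strip-⊆ sa′ m)) (λ m → gb (Strip-⊆ sb m))
... | rest with Strip-from (opening s) (ScanSplitting.zs-desc rest)
              | Strip-from (closing s) (ScanSplitting.ts-desc rest)
... | _ , sz , dz | _ , st , dt = record
  { zs-desc           = dz
  ; ts-desc           = dt
  ; gaps              = step st sz (gapStep-split s count (λ t → ga (from (Strip-∈⇔ sa′) t))
                                                 (λ t → gb (from (Strip-∈⇔ sb) t))) gaps
  ; paired            = Valuewise-cons SplitValues-cong sz st sa′ sb (SplitValues-shape s) paired
  ; barred-replaced   = Valuewise-cons Replaced-cong sb′ sb sz st (Replaced-barred s) barred-replaced
  ; unbarred-replaced = Valuewise-cons Replaced-cong sa sa′ sz st (Replaced-unbarred s) unbarred-replaced }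
  where open ScanSplitting rest

scanSplitting⇒word : ∀ {G v c a a′ b b′} → ScanSplitting G v c a a′ b b′ →
                     (∀ w → w ≤ v → G w → w ∈ a′ ⊎ w ∈ b) →
                     Desc v a → Desc v a′ → Desc v b → Desc v b′ → Word v c a a′ b b′
scanSplitting⇒word (scanSplitting _ _ _ _ done _ _ _) _ da da′ db db′
  rewrite Desc-zero da | Desc-zero da′ | Desc-zero db | Desc-zero db′ = done
scanSplitting⇒word {G} {suc v} (scanSplitting _ _ dz dt (step {bx = bt} {by = bz} st sz stp scan) pv rb ra)
                   cov da da′ db db′
  with strip-view da | strip-view da′ | strip-view db | strip-view db′
... | ba , a₁ , sa , da₁ | ba′ , a₁′ , sa′ , da₁′ | bb , b₁ , sb , db₁ | bb′ , b₁′ , sb′ , db₁′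
  with splitShape-from ba ba′ bb bb′ bz bt (Valuewise-head SplitValues-cong sz st sa′ sb pv)
         (Valuewise-head Replaced-cong sb′ sb sz st rb) (Valuewise-head Replaced-cong sa sa′ sz st ra)
... | split s =
  step sa sa′ sb sb′ s
    (count-from-splitGapStep s stp (λ g → Sum.map (to (Strip-∈⇔ sa′)) (to (Strip-∈⇔ sb)) (cov (suc v) ≤-refl g)))
    (scanSplitting⇒word
       (scanSplitting _ _ dz₁ dt₁ scan
          (Valuewise-tail SplitValues-cong SplitValues-∅ sz st sa′ sb dz₁ dt₁ da₁′ db₁ pv)
          (Valuewise-tail Replaced-cong Replaced-∅ sb′ sb sz st db₁′ db₁ dz₁ dt₁ rb)
          (Valuewise-tail Replaced-cong Replaced-∅ sa sa′ sz st da₁ da₁′ dz₁ dt₁ ra))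
       cov′ da₁ da₁′ db₁ db₁′)
  where
  dz₁ = Strip-Desc sz dz
  dt₁ = Strip-Desc st dt
  cov′ : ∀ w → w ≤ v → G w → w ∈ a₁′ ⊎ w ∈ b₁
  cov′ w w≤v g = Sum.map (Strip-∈-below sa′ w≤v) (Strip-∈-below sb w≤v) (cov w (m≤n⇒m≤1+n w≤v) g)

∈-reverse⇔ : ∀ {A : Set} {x : A} {xs} → x ∈ reverse xs ⇔ x ∈ xs
∈-reverse⇔ = mk⇔ Any.reverse⁻ Any.reverse⁺

AllPairs-reverse : ∀ {A : Set} {R : A → A → Set} {xs} → AllPairs R xs → AllPairs (flip R) (reverse xs)
AllPairs-reverse {xs = []}     []         = []
AllPairs-reverse {xs = x ∷ xs} (rx ∷ rxs) rewrite unfold-reverse x xs =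
  AllPairsₚ.++⁺ (AllPairs-reverse rxs) ([] ∷ []) (All.tabulate λ m → All.lookup rx (Any.reverse⁻ m) ∷ [])

All-reverse : ∀ {A : Set} {P : A → Set} {xs} → All P xs → All P (reverse xs)
All-reverse ps = All.tabulate λ m → All.lookup ps (Any.reverse⁻ m)

∈-posVals⇔ : ∀ {x} D → x ∈ posVals D ⇔ pl x ∈ D
∈-posVals⇔ []          = mk⇔ (λ ()) (λ ())
∈-posVals⇔ (pl i ∷ D) = mk⇔ (λ { (here refl) → here refl ; (there m) → there (to (∈-posVals⇔ D) m) })
                             (λ { (here refl) → here refl ; (there m) → there (from (∈-posVals⇔ D) m) })
∈-posVals⇔ (mi i ∷ D) = mk⇔ (λ m → there (to (∈-posVals⇔ D) m))
                             (λ { (here ()) ; (there m) → from (∈-posVals⇔ D) m })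

∈-negVals⇔ : ∀ {x} D → x ∈ negVals D ⇔ mi x ∈ D
∈-negVals⇔ []          = mk⇔ (λ ()) (λ ())
∈-negVals⇔ (mi i ∷ D) = mk⇔ (λ { (here refl) → here refl ; (there m) → there (to (∈-negVals⇔ D) m) })
                             (λ { (here refl) → here refl ; (there m) → there (from (∈-negVals⇔ D) m) })
∈-negVals⇔ (pl i ∷ D) = mk⇔ (λ m → there (to (∈-negVals⇔ D) m))
                             (λ { (here ()) ; (there m) → from (∈-negVals⇔ D) m })

private
  posVals-above-mi : ∀ {i D} → All (mi i <ₑ_) D → posVals D ≡ []
  posVals-above-mi {D = []}       []               = refl
  posVals-above-mi {D = mi _ ∷ _} (_ ∷ above) = posVals-above-mi above

  posVals-above : ∀ {i D} → All (pl i <ₑ_) D → All (i <_) (posVals D)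
  posVals-above {D = []}       []                    = []
  posVals-above {D = pl _ ∷ _} (pl<pl i<j ∷ above) = i<j ∷ posVals-above above
  posVals-above {D = mi _ ∷ _} (_ ∷ above)         = posVals-above above

  negVals-above : ∀ {i D} → All (mi i <ₑ_) D → All (_< i) (negVals D)
  negVals-above {D = []}       []                    = []
  negVals-above {D = mi _ ∷ _} (mi<mi j<i ∷ above) = j<i ∷ negVals-above above

sorted-split : ∀ {D} → AllPairs _<ₑ_ D → D ≡ map pl (posVals D) ++ map mi (negVals D)
sorted-split {[]}       _             = refl
sorted-split {pl i ∷ D} (_ ∷ sorted) = cong (pl i ∷_) (sorted-split sorted)
sorted-split {mi i ∷ D} (above ∷ sorted) with sorted-split sorted
... | D≡ rewrite posVals-above-mi above = cong (mi i ∷_) D≡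

posVals-increasing : ∀ {D} → AllPairs _<ₑ_ D → AllPairs _<_ (posVals D)
posVals-increasing {[]}       _                = []
posVals-increasing {pl i ∷ D} (above ∷ sorted) = posVals-above above ∷ posVals-increasing sorted
posVals-increasing {mi i ∷ D} (_ ∷ sorted)     = posVals-increasing sorted

negVals-decreasing : ∀ {D} → AllPairs _<ₑ_ D → AllPairs _>_ (negVals D)
negVals-decreasing {[]}       _                = []
negVals-decreasing {pl i ∷ D} (_ ∷ sorted)     = negVals-decreasing sorted
negVals-decreasing {mi i ∷ D} (above ∷ sorted) = negVals-above above ∷ negVals-decreasing sorted

posVals-inSegment : ∀ {n D} → All (InRange n) D → All (InSegment n) (posVals D)
posVals-inSegment {D = []}       []       = []
posVals-inSegment {D = pl _ ∷ _} (r ∷ rs) = r ∷ posVals-inSegment rs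
posVals-inSegment {D = mi _ ∷ _} (_ ∷ rs) = posVals-inSegment rs

negVals-inSegment : ∀ {n D} → All (InRange n) D → All (InSegment n) (negVals D)
negVals-inSegment {D = []}       []       = []
negVals-inSegment {D = pl _ ∷ _} (_ ∷ rs) = negVals-inSegment rs
negVals-inSegment {D = mi _ ∷ _} (r ∷ rs) = r ∷ negVals-inSegment rs

-- The unbarred values of a column, listed decreasingly like the barred ones.
posDesc : List Ent → List ℕ
posDesc D = reverse (posVals D)

∈-posDesc⇔ : ∀ {x} D → x ∈ posDesc D ⇔ pl x ∈ D
∈-posDesc⇔ D = ⇔-trans ∈-reverse⇔ (∈-posVals⇔ D)

posDesc-Desc : ∀ {n D} → SortedColumn n D → Desc n (posDesc D)
posDesc-Desc ((range , sorted) , _) = AllPairs-reverse (posVals-increasing sorted) , All-reverse (posVals-inSegment range)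

negVals-Desc : ∀ {n D} → SortedColumn n D → Desc n (negVals D)
negVals-Desc ((range , sorted) , _) = negVals-decreasing sorted , negVals-inSegment range

sorted-disjoint : ∀ {n D} → SortedColumn n D → Disjoint (posDesc D) (negVals D)
sorted-disjoint {D = D} (_ , no-pair) (m₁ , m₂) = no-pair _ (to (∈-posDesc⇔ D) m₁ , to (∈-negVals⇔ D) m₂)

Chain : Maybe ℕ → List ℕ → Set
Chain p []       = ⊤
Chain p (x ∷ xs) = BelowN p x × Chain (just x) xs

decreasing⇒Chain : ∀ {xs} → AllPairs _>_ xs → Chain nothing xs
decreasing⇒Chain = go (All.tabulate (λ _ → tt))
  where
  go : ∀ {p xs} → All (BelowN p) xs → AllPairs _>_ xs → Chain p xs
  go []          []           = tt
  go (below ∷ _) (x>xs ∷ dec) = below , go x>xs dec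

Chain⇒decreasing : ∀ {p} xs → Chain p xs → AllPairs _>_ xs
Chain⇒decreasing []       _           = []
Chain⇒decreasing (x ∷ xs) (_ , chain) = below x xs chain ∷ Chain⇒decreasing xs chain
  where
  below : ∀ x xs → Chain (just x) xs → All (_< x) xs
  below x []       _                 = []
  below x (y ∷ ys) (y<x , chain) = y<x ∷ All.map (λ z<y → <-trans z<y y<x) (below y ys chain)

private
  ∈-map-+⇔ : ∀ {w A} → + w ∈ map +_ A ⇔ w ∈ A
  ∈-map-+⇔ {A = A} = mk⇔ (λ m → let _ , x∈A , +w≡+x = ∈-map⁻ +_ m in subst (_∈ A) (sym (ℤ.+-injective +w≡+x)) x∈A)
                         (∈-map⁺ +_)

  BelowZ⇒BelowN : ∀ p {c} → BelowZ (Maybe.map +_ p) (+ c) → BelowN p c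
  BelowZ⇒BelowN nothing  _             = tt
  BelowZ⇒BelowN (just _) (ℤ.+<+ c<u) = c<u

  BelowN⇒BelowZ : ∀ p {c} → BelowN p c → BelowZ (Maybe.map +_ p) (+ c)
  BelowN⇒BelowZ nothing  _   = tt
  BelowN⇒BelowZ (just _) c<u = ℤ.+<+ c<u

-- maxcol(B, A′) = B′ says each entry of B′ is reached from the entry of B
-- above it by jumping down over entries of A′ only.
maxcol⇒gapsIn : ∀ A′ p b b′ → MaxcolDesc (Maybe.map +_ p) (map +_ b) (map +_ A′) (map +_ b′) →
                GapsIn (_∈ A′) p b′ b
maxcol⇒gapsIn A′ p []      []        _ = tt
maxcol⇒gapsIn A′ p (a ∷ b) (c ∷ b′) (((ℤ.+≤+ c≤a , _) , greatest) , rest) =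
  c≤a , gap , maxcol⇒gapsIn A′ (just c) b b′ rest
  where
  gap : ∀ w → c < w → w ≤ a → BelowN p w → w ∈ A′
  gap w c<w w≤a below with w ∈? A′
  ... | yes w∈A′ = w∈A′
  ... | no  w∉A′ = ⊥-elim (<⇒≱ c<w (ℤ.drop‿+≤+ (greatest (+ w)
                     (ℤ.+≤+ w≤a , BelowN⇒BelowZ p below , λ m → w∉A′ (to ∈-map-+⇔ m)))))

gapsIn⇒maxcol : ∀ A′ p b b′ → GapsIn (_∈ A′) p b′ b → Chain p b′ → All (_∉ A′) b′ →
                MaxcolDesc (Maybe.map +_ p) (map +_ b) (map +_ A′) (map +_ b′)
gapsIn⇒maxcol A′ p []      []        _ _ _ = tt
gapsIn⇒maxcol A′ p (a ∷ b) (c ∷ b′) (c≤a , gap , rest) (below , chain) (c∉A′ ∷ b′∉A′) =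
  ((ℤ.+≤+ c≤a , BelowN⇒BelowZ p below , λ m → c∉A′ (to ∈-map-+⇔ m)) , greatest) ,
  gapsIn⇒maxcol A′ (just c) b b′ rest chain b′∉A′
  where
  greatest : ∀ d → d ℤ.≤ + a × BelowZ (Maybe.map +_ p) d × d ∉ map +_ A′ → d ℤ.≤ + c
  greatest -[1+ _ ] _ = ℤ.-≤+
  greatest (+ w) (ℤ.+≤+ w≤a , below , w∉A′) with w ≤? c
  ... | yes w≤c = ℤ.+≤+ w≤c
  ... | no  w≰c = ⊥-elim (w∉A′ (from ∈-map-+⇔ (gap w (≰⇒> w≰c) w≤a (BelowZ⇒BelowN p below))))

-- Condition (2)

ColumnWord : ℕ → List Ent → List Ent → Set
ColumnWord n D′ D = Word n 0 (posDesc D) (posDesc D′) (negVals D) (negVals D′)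

cond2⇔word : ∀ {n D′ D} → SortedColumn n D′ → SortedColumn n D → Cond2 D′ D ⇔ ColumnWord n D′ D
cond2⇔word {n} {D′} {D} s′ s = mk⇔ cond2⇒word word⇒cond2
  where
  A′ = posVals D′
  b  = negVals D
  b′ = negVals D′
  maxcol≡ : IsMaxcol (reverse (map +_ b)) (map +_ A′) (reverse (map +_ b′)) ≡
            MaxcolDesc nothing (map +_ b) (map +_ A′) (map +_ b′)
  maxcol≡ = cong₂ (λ X Y → MaxcolDesc nothing X (map +_ A′) Y) (reverse-involutive _) (reverse-involutive _)
  b′∉A′ : All (_∉ A′) b′
  b′∉A′ = All.tabulate λ m m′ → proj₂ s′ _ (to (∈-posVals⇔ D′) m′ , to (∈-negVals⇔ D′) m)

  cond2⇒word : Cond2 D′ D → ColumnWord n D′ D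
  cond2⇒word (maxcol , rule) =
    gaps-UnbarredRule⇒word
      (gapsIn⇒gapScan (negVals-Desc s′) (negVals-Desc s) (maxcol⇒gapsIn A′ nothing b b′ (subst id maxcol≡ maxcol)))
      (λ w → UnbarredRule-cong (⇔-sym ∈-reverse⇔) (⇔-sym ∈-reverse⇔) (⇔-id _) (⇔-id _) (rule w))
      (sorted-disjoint s) (sorted-disjoint s′) (λ _ _ m → from ∈-reverse⇔ m)
      (posDesc-Desc s) (posDesc-Desc s′) (negVals-Desc s) (negVals-Desc s′)

  word⇒cond2 : ColumnWord n D′ D → Cond2 D′ D
  word⇒cond2 word with word⇒gaps-UnbarredRule word (to ∈-reverse⇔)
  ... | gaps , rule =
    subst id (sym maxcol≡)
      (gapsIn⇒maxcol A′ nothing b b′ (gapScan⇒gapsIn gaps) (decreasing⇒Chain (proj₁ (negVals-Desc s′))) b′∉A′) ,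
    λ w → UnbarredRule-cong ∈-reverse⇔ ∈-reverse⇔ (⇔-id _) (⇔-id _) (rule w)

Unique-decreasing : ∀ {xs} → AllPairs _>_ xs → Unique xs
Unique-decreasing = AllPairs.map (λ x>y x≡y → <-irrefl (sym x≡y) x>y)

Unique-increasing : ∀ {xs} → AllPairs _<_ xs → Unique xs
Unique-increasing = AllPairs.map (λ x<y x≡y → <-irrefl x≡y x<y)

Unique-map : ∀ {f : ℕ → ℕ} {X} → Unique X → (∀ {x y} → x ∈ X → y ∈ X → f x ≡ f y → x ≡ y) → Unique (map f X)
Unique-map {X = []}    []           _   = []
Unique-map {f} {X = x ∷ X} (x∉X ∷ uX) inj =
  All.tabulate (λ m fx≡ → distinct (∈-map⁻ f m) fx≡) ∷ Unique-map uX (λ mx my → inj (there mx) (there my))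
  where
  distinct : ∀ {w} → (∃ λ y → y ∈ X × w ≡ f y) → f x ≢ w
  distinct (y , y∈X , refl) fx≡fy = All.lookup x∉X y∈X (inj (here refl) (there y∈X) fx≡fy)

∈-map⇔ : ∀ {f : ℕ → ℕ} {X w} → w ∈ map f X ⇔ (∃ λ y → y ∈ X × f y ≡ w)
∈-map⇔ {f} = mk⇔ (λ m → let y , y∈X , w≡ = ∈-map⁻ f m in y , y∈X , sym w≡)
                 λ { (_ , y∈X , refl) → ∈-map⁺ f y∈X }

private
  lookupPair-hit : ∀ z t ps x → x ≡ z → lookupPair ((z , t) ∷ ps) x ≡ t
  lookupPair-hit z t ps x x≡z with x ≡ᵇ z in eq
  ... | true  = refl
  ... | false = ⊥-elim (subst T eq (≡⇒≡ᵇ x z x≡z))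

  lookupPair-miss : ∀ z t ps x → x ≢ z → lookupPair ((z , t) ∷ ps) x ≡ lookupPair ps x
  lookupPair-miss z t ps x x≢z with x ≡ᵇ z in eq
  ... | true  = ⊥-elim (x≢z (≡ᵇ⇒≡ x z (subst T (sym eq) tt)))
  ... | false = refl

lookupPair-∉ : ∀ zs ts x → x ∉ zs → lookupPair (zip zs ts) x ≡ x
lookupPair-∉ []       _        _ _   = refl
lookupPair-∉ (_ ∷ _)  []       _ _   = refl
lookupPair-∉ (z ∷ zs) (t ∷ ts) x x∉ =
  trans (lookupPair-miss z t (zip zs ts) x (x∉ ∘ here)) (lookupPair-∉ zs ts x (x∉ ∘ there))

lookupPair-∈ : ∀ zs ts x → x ∈ zs → length zs ≡ length ts → lookupPair (zip zs ts) x ∈ ts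
lookupPair-∈ (z ∷ zs) (t ∷ ts) x x∈ len with x ≟ z | x∈
... | yes x≡z | _         rewrite lookupPair-hit z t (zip zs ts) x x≡z = here refl
... | no  x≢z | here x≡z  = ⊥-elim (x≢z x≡z)
... | no  x≢z | there x∈′ rewrite lookupPair-miss z t (zip zs ts) x x≢z =
  there (lookupPair-∈ zs ts x x∈′ (suc-injective len))

lookupPair-onto : ∀ zs ts {w} → w ∈ ts → Unique zs → length zs ≡ length ts →
                  ∃ λ z → z ∈ zs × lookupPair (zip zs ts) z ≡ w
lookupPair-onto (z ∷ zs) (t ∷ ts) (here refl) _ _ = z , here refl , lookupPair-hit z t (zip zs ts) z refl
lookupPair-onto (z ∷ zs) (t ∷ ts) (there w∈) (z∉ ∷ uz) len with lookupPair-onto zs ts w∈ uz (suc-injective len)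
... | y , y∈ , y↦w = y , there y∈ , trans (lookupPair-miss z t (zip zs ts) y (λ y≡z → All.lookup z∉ y∈ (sym y≡z))) y↦w

lookupPair-injective-zs : ∀ zs ts {x y} → x ∈ zs → y ∈ zs → Unique ts → length zs ≡ length ts →
                          lookupPair (zip zs ts) x ≡ lookupPair (zip zs ts) y → x ≡ y
lookupPair-injective-zs (z ∷ zs) (t ∷ ts) {x} {y} x∈ y∈ (t∉ ∷ uts) len eq with x ≟ z | y ≟ z | x∈ | y∈
... | yes x≡z | yes y≡z | _ | _ = trans x≡z (sym y≡z)
... | yes x≡z | no y≢z | _ | here y≡z = ⊥-elim (y≢z y≡z)
... | yes x≡z | no y≢z | _ | there y∈′ = ⊥-elim (All.lookup t∉ (lookupPair-∈ zs ts y y∈′ (suc-injective len))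
    (trans (sym (lookupPair-hit z t (zip zs ts) x x≡z)) (trans eq (lookupPair-miss z t (zip zs ts) y y≢z))))
... | no x≢z | yes y≡z | here x≡z | _ = ⊥-elim (x≢z x≡z)
... | no x≢z | yes y≡z | there x∈′ | _ = ⊥-elim (All.lookup t∉ (lookupPair-∈ zs ts x x∈′ (suc-injective len))
    (trans (sym (lookupPair-hit z t (zip zs ts) y y≡z)) (trans (sym eq) (lookupPair-miss z t (zip zs ts) x x≢z))))
... | no x≢z | no y≢z | here x≡z | _ = ⊥-elim (x≢z x≡z)
... | no x≢z | no y≢z | _ | here y≡z = ⊥-elim (y≢z y≡z)
... | no x≢z | no y≢z | there x∈′ | there y∈′ = lookupPair-injective-zs zs ts x∈′ y∈′ uts (suc-injective len)
    (trans (sym (lookupPair-miss z t (zip zs ts) x x≢z)) (trans eq (lookupPair-miss z t (zip zs ts) y y≢z)))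

lookupPair-injectiveOn : ∀ zs ts {X} → Unique ts → length zs ≡ length ts → Disjoint ts X →
                         ∀ {x y} → x ∈ X → y ∈ X → lookupPair (zip zs ts) x ≡ lookupPair (zip zs ts) y → x ≡ y
lookupPair-injectiveOn zs ts ut len ts#X {x} {y} x∈ y∈ eq with x ∈? zs | y ∈? zs
... | yes x∈zs | yes y∈zs = lookupPair-injective-zs zs ts x∈zs y∈zs ut len eq
... | yes x∈zs | no  y∉zs =
  ⊥-elim (ts#X (subst (_∈ ts) (trans eq (lookupPair-∉ zs ts y y∉zs)) (lookupPair-∈ zs ts x x∈zs len) , y∈))
... | no  x∉zs | yes y∈zs =
  ⊥-elim (ts#X (subst (_∈ ts) (trans (sym eq) (lookupPair-∉ zs ts x x∉zs)) (lookupPair-∈ zs ts y y∈zs len) , x∈))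
... | no  x∉zs | no  y∉zs = trans (sym (lookupPair-∉ zs ts x x∉zs)) (trans eq (lookupPair-∉ zs ts y y∉zs))

lookupPair-image⇔ : ∀ zs ts {X w} → (∀ {z} → z ∈ zs → z ∈ X) → Unique zs → length zs ≡ length ts →
                    (∃ λ y → y ∈ X × lookupPair (zip zs ts) y ≡ w) ⇔ ((w ∈ X × w ∉ zs) ⊎ w ∈ ts)
lookupPair-image⇔ zs ts {X} {w} zs⊆X uz len = mk⇔ image⇒ image⇐
  where
  image⇒ : (∃ λ y → y ∈ X × lookupPair (zip zs ts) y ≡ w) → (w ∈ X × w ∉ zs) ⊎ w ∈ ts
  image⇒ (y , y∈X , refl) with y ∈? zs
  ... | yes y∈zs = inj₂ (lookupPair-∈ zs ts y y∈zs len)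
  ... | no  y∉zs rewrite lookupPair-∉ zs ts y y∉zs = inj₁ (y∈X , y∉zs)
  image⇐ : (w ∈ X × w ∉ zs) ⊎ w ∈ ts → ∃ λ y → y ∈ X × lookupPair (zip zs ts) y ≡ w
  image⇐ (inj₁ (w∈X , w∉zs)) = w , w∈X , lookupPair-∉ zs ts w w∉zs
  image⇐ (inj₂ w∈ts) with lookupPair-onto zs ts w∈ts uz len
  ... | z , z∈zs , z↦w = z , zs⊆X z∈zs , z↦w

unique-set⇒↭ : ∀ {xs ys : List ℕ} → Unique xs → Unique ys → (∀ {w} → w ∈ xs ⇔ w ∈ ys) → xs ↭ ys
unique-set⇒↭ ux uy same = ∼bag⇒↭ (unique∧set⇒bag ux uy same)

columnOf : List ℕ → List ℕ → List Ent
columnOf X Y = map pl X ++ map mi Y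

private
  posVals-columnOf : ∀ X Y → posVals (columnOf X Y) ≡ X
  posVals-columnOf (x ∷ X) Y       = cong (x ∷_) (posVals-columnOf X Y)
  posVals-columnOf []      []      = refl
  posVals-columnOf []      (_ ∷ Y) = posVals-columnOf [] Y

  negVals-columnOf : ∀ X Y → negVals (columnOf X Y) ≡ Y
  negVals-columnOf (_ ∷ X) Y       = negVals-columnOf X Y
  negVals-columnOf []      []      = refl
  negVals-columnOf []      (y ∷ Y) = cong (y ∷_) (negVals-columnOf [] Y)

∈-pl-columnOf⇔ : ∀ X Y {w} → pl w ∈ columnOf X Y ⇔ w ∈ X
∈-pl-columnOf⇔ X Y {w} =
  subst (λ Z → pl w ∈ columnOf X Y ⇔ w ∈ Z) (posVals-columnOf X Y) (⇔-sym (∈-posVals⇔ (columnOf X Y)))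

∈-mi-columnOf⇔ : ∀ X Y {w} → mi w ∈ columnOf X Y ⇔ w ∈ Y
∈-mi-columnOf⇔ X Y {w} =
  subst (λ Z → mi w ∈ columnOf X Y ⇔ w ∈ Z) (negVals-columnOf X Y) (⇔-sym (∈-negVals⇔ (columnOf X Y)))

columnOf-sorted : ∀ {X Y} → AllPairs _<_ X → AllPairs _>_ Y → AllPairs _<ₑ_ (columnOf X Y)
columnOf-sorted incX decY =
  AllPairsₚ.++⁺ (AllPairsₚ.map⁺ (AllPairs.map pl<pl incX)) (AllPairsₚ.map⁺ (AllPairs.map mi<mi decY))
    (All.tabulate λ m → All.tabulate λ m′ → pl-below-mi (∈-map⁻ pl m) (∈-map⁻ mi m′))
  where
  pl-below-mi : ∀ {e e′} → (∃ λ x → _ × e ≡ pl x) → (∃ λ y → _ × e′ ≡ mi y) → e <ₑ e′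
  pl-below-mi (_ , _ , refl) (_ , _ , refl) = pl<mi

columnOf-inRange : ∀ {n X Y} → All (InSegment n) X → All (InSegment n) Y → All (InRange n) (columnOf X Y)
columnOf-inRange rX rY = All.++⁺ (All.map⁺ rX) (All.map⁺ rY)

rSubst-columnOf : ∀ ps X Y → map (rSubst ps) (columnOf X Y) ≡ columnOf X (map (lookupPair ps) Y)
rSubst-columnOf ps (x ∷ X) Y       = cong (pl x ∷_) (rSubst-columnOf ps X Y)
rSubst-columnOf ps []      []      = refl
rSubst-columnOf ps []      (y ∷ Y) = cong (mi (lookupPair ps y) ∷_) (rSubst-columnOf ps [] Y)

lSubst-columnOf : ∀ ps X Y → map (lSubst ps) (columnOf X Y) ≡ columnOf (map (lookupPair ps) X) Y
lSubst-columnOf ps (x ∷ X) Y       = cong (pl (lookupPair ps x) ∷_) (lSubst-columnOf ps X Y)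
lSubst-columnOf ps []      []      = refl
lSubst-columnOf ps []      (y ∷ Y) = cong (mi y ∷_) (lSubst-columnOf ps [] Y)

∈-mi-rSubst⇔ : ∀ ps E {w} → mi w ∈ map (rSubst ps) E ⇔ (∃ λ y → mi y ∈ E × lookupPair ps y ≡ w)
∈-mi-rSubst⇔ ps E = mk⇔ image (λ { (_ , m , refl) → ∈-map⁺ (rSubst ps) m })
  where
  image : ∀ {w} → mi w ∈ map (rSubst ps) E → ∃ λ y → mi y ∈ E × lookupPair ps y ≡ w
  image m with ∈-map⁻ (rSubst ps) m
  ... | mi y , m′ , refl = y , m′ , refl

∈-pl-lSubst⇔ : ∀ ps E {w} → pl w ∈ map (lSubst ps) E ⇔ (∃ λ y → pl y ∈ E × lookupPair ps y ≡ w)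
∈-pl-lSubst⇔ ps E = mk⇔ image (λ { (_ , m , refl) → ∈-map⁺ (lSubst ps) m })
  where
  image : ∀ {w} → pl w ∈ map (lSubst ps) E → ∃ λ y → pl y ∈ E × lookupPair ps y ≡ w
  image m with ∈-map⁻ (lSubst ps) m
  ... | pl y , m′ , refl = y , m′ , refl

-- G u is meant to say that u or ū is an entry of E.
module _ (n : ℕ) (E : List Ent) {G : ℕ → Set} (G? : ∀ u → Dec (G u))
         (free⇒¬G : ∀ {u} → Free n E u → ¬ G u) (¬G⇒free : ∀ {u} → 1 ≤ u → u ≤ n → ¬ G u → Free n E u) where

  splitFrom⇒gapsIn : ∀ p zs ts → SplitFrom n E p zs ts → All G zs → All (_≤ n) zs →
                     GapsIn G p ts zs × All (Free n E) ts × Chain p ts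
  splitFrom⇒gapsIn p []       []       _ _ _ = tt , [] , tt
  splitFrom⇒gapsIn p (z ∷ zs) (t ∷ ts) (((free-t , t<z , below) , greatest) , rest) (Gz ∷ Gzs) (z≤max ∷ zs≤max)
    with splitFrom⇒gapsIn (just t) zs ts rest Gzs zs≤max
  ... | gaps , frees , chain = (<⇒≤ t<z , gap , gaps) , free-t ∷ frees , below , chain
    where
    gap : ∀ w → t < w → w ≤ z → BelowN p w → G w
    gap w t<w w≤z below-w with G? w | w ≟ z
    ... | yes Gw | _        = Gw
    ... | no ¬Gw | yes refl = ⊥-elim (¬Gw Gz)
    ... | no ¬Gw | no w≢z   = ⊥-elim (<⇒≱ t<w (greatest w
            (¬G⇒free (≤-trans (proj₁ free-t) (<⇒≤ t<w)) (≤-trans w≤z z≤max) ¬Gw , ≤∧≢⇒< w≤z w≢z , below-w)))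

  gapsIn⇒splitFrom : ∀ p zs ts → GapsIn G p ts zs → All (Free n E) ts → Chain p ts → All G zs →
                     SplitFrom n E p zs ts
  gapsIn⇒splitFrom p []       []       _ _ _ _ = tt
  gapsIn⇒splitFrom p (z ∷ zs) (t ∷ ts) (t≤z , gap , gaps) (free-t ∷ frees) (below , chain) (Gz ∷ Gzs) =
    ((free-t , ≤∧≢⇒< t≤z (λ t≡z → free⇒¬G free-t (subst G (sym t≡z) Gz)) , below) , greatest) ,
    gapsIn⇒splitFrom (just t) zs ts gaps frees chain Gzs
    where
    greatest : ∀ u → Free n E u × u < z × BelowN p u → u ≤ t
    greatest u (free-u , u<z , below-u) with u ≤? t
    ... | yes u≤t = u≤t
    ... | no  u≰t = ⊥-elim (free⇒¬G free-u (gap u (≰⇒> u≰t) (<⇒≤ u<z) below-u))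

-- Condition (3)

↭⇒∈⇔ : ∀ {A : Set} {xs ys : List A} {x} → xs ↭ ys → x ∈ xs ⇔ x ∈ ys
↭⇒∈⇔ p = mk⇔ (∈-resp-↭ p) (∈-resp-↭ (↭-sym p))

∃-⇔ : ∀ {P Q R : ℕ → Set} → (∀ {y} → P y ⇔ Q y) → (∃ λ y → P y × R y) ⇔ (∃ λ y → Q y × R y)
∃-⇔ P⇔Q = mk⇔ (λ (y , p , r) → y , to P⇔Q p , r) (λ (y , q , r) → y , from P⇔Q q , r)

module _ {n D′ D} (s′ : SortedColumn n D′) (s : SortedColumn n D) where
  private
    A  = posVals D
    A′ = posVals D′
    a  = posDesc D
    a′ = posDesc D′
    b  = negVals D
    b′ = negVals D′

    Occupied : ℕ → Set
    Occupied w = w ∈ a′ ⊎ w ∈ b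

    occupied? : ∀ w → Dec (Occupied w)
    occupied? w with w ∈? a′ | w ∈? b
    ... | yes w∈a′ | _       = yes (inj₁ w∈a′)
    ... | no  _    | yes w∈b = yes (inj₂ w∈b)
    ... | no  w∉a′ | no  w∉b = no [ w∉a′ , w∉b ]

    module Occupying (E : List Ent) (E₊ : ∀ {x} → pl x ∈ E ⇔ x ∈ a′) (E₋ : ∀ {x} → mi x ∈ E ⇔ x ∈ b) where
      free⇒unoccupied : ∀ {u} → Free n E u → ¬ Occupied u
      free⇒unoccupied (_ , _ , pl∉ , mi∉) = [ pl∉ ∘ from E₊ , mi∉ ∘ from E₋ ]

      unoccupied⇒free : ∀ {u} → 1 ≤ u → u ≤ n → ¬ Occupied u → Free n E u
      unoccupied⇒free 1≤u u≤n ¬occ = 1≤u , u≤n , ¬occ ∘ inj₁ ∘ to E₊ , ¬occ ∘ inj₂ ∘ to E₋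

  cond3⇒word : Cond3 n D′ D → ColumnWord n D′ D
  cond3⇒word (E , zs , ts , _ , ((zs-dec , zs-pairs) , splits) , plE , miE , isR , isL) =
    scanSplitting⇒word
      (scanSplitting zs ts zs-desc ts-desc (gapsIn⇒gapScan ts-desc zs-desc gaps) paired barred-replaced unbarred-replaced)
      (λ _ _ occ → occ) (posDesc-Desc s) (posDesc-Desc s′) (negVals-Desc s) (negVals-Desc s′)
    where
    E₊ : ∀ {x} → pl x ∈ E ⇔ x ∈ a′
    E₊ = ⇔-trans (plE _) (⇔-sym ∈-reverse⇔)
    E₋ : ∀ {x} → mi x ∈ E ⇔ x ∈ b
    E₋ = miE _
    open Occupying E E₊ E₋
    zs-paired : ∀ w → w ∈ zs ⇔ (w ∈ a′ × w ∈ b)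
    zs-paired w = ⇔-trans (zs-pairs w) (E₊ ×-⇔ E₋)
    zs⊆a′ : ∀ {z} → z ∈ zs → z ∈ a′
    zs⊆a′ m = proj₁ (to (zs-paired _) m)
    zs⊆b : ∀ {z} → z ∈ zs → z ∈ b
    zs⊆b m = proj₂ (to (zs-paired _) m)
    zs-desc : Desc n zs
    zs-desc = zs-dec , All.tabulate (λ m → All.lookup (proj₂ (posDesc-Desc s′)) (zs⊆a′ m))
    splitting = splitFrom⇒gapsIn n E occupied? free⇒unoccupied unoccupied⇒free nothing zs ts splits
                  (All.tabulate (λ m → inj₁ (zs⊆a′ m))) (All.map proj₂ (proj₂ zs-desc))
    gaps = proj₁ splitting
    frees = proj₁ (proj₂ splitting)
    ts-desc : Desc n ts
    ts-desc = Chain⇒decreasing ts (proj₂ (proj₂ splitting)) , All.map (λ (1≤t , t≤n , _) → 1≤t , t≤n) frees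
    paired : Valuewise SplitValues zs ts a′ b
    paired w = zs-paired w , λ w∈ts → let _ , _ , pl∉ , mi∉ = All.lookup frees w∈ts
                                      in (λ m → pl∉ (from E₊ m)) , (λ m → mi∉ (from E₋ m))
    len : length zs ≡ length ts
    len = sym (GapsIn-length ts zs gaps)
    open EquationalReasoning
    barred-replaced : Valuewise Replaced b′ b zs ts
    barred-replaced w = begin
      w ∈ b′                                              ∼⟨ ∈-negVals⇔ D′ ⟩
      mi w ∈ D′                                           ∼⟨ ↭⇒∈⇔ isR ⟩
      mi w ∈ map (rSubst (zip zs ts)) E                   ∼⟨ ∈-mi-rSubst⇔ _ E ⟩
      (∃ λ y → mi y ∈ E × lookupPair (zip zs ts) y ≡ w)   ∼⟨ ∃-⇔ E₋ ⟩
      (∃ λ y → y ∈ b × lookupPair (zip zs ts) y ≡ w)      ∼⟨ lookupPair-image⇔ zs ts zs⊆b (Unique-decreasing zs-dec) len ⟩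
      ((w ∈ b × w ∉ zs) ⊎ w ∈ ts)                         ∎
    unbarred-replaced : Valuewise Replaced a a′ zs ts
    unbarred-replaced w = begin
      w ∈ a                                               ∼⟨ ∈-posDesc⇔ D ⟩
      pl w ∈ D                                            ∼⟨ ↭⇒∈⇔ isL ⟩
      pl w ∈ map (lSubst (zip zs ts)) E                   ∼⟨ ∈-pl-lSubst⇔ _ E ⟩
      (∃ λ y → pl y ∈ E × lookupPair (zip zs ts) y ≡ w)   ∼⟨ ∃-⇔ E₊ ⟩
      (∃ λ y → y ∈ a′ × lookupPair (zip zs ts) y ≡ w)     ∼⟨ lookupPair-image⇔ zs ts zs⊆a′ (Unique-decreasing zs-dec) len ⟩
      ((w ∈ a′ × w ∉ zs) ⊎ w ∈ ts)                        ∎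

  word⇒cond3 : ColumnWord n D′ D → Cond3 n D′ D
  word⇒cond3 word =
    E , zs , ts , inc , ((proj₁ zs-desc , λ z → ⇔-trans (proj₁ (paired z)) (⇔-sym (E₊ ×-⇔ E₋))) , splits) ,
    (λ _ → ∈-pl-columnOf⇔ A′ b) , (λ _ → E₋) , isR , isL
    where
    open ScanSplitting (word⇒scanSplitting word inj₁ inj₂)
    E = columnOf A′ b
    E₊ : ∀ {x} → pl x ∈ E ⇔ x ∈ a′
    E₊ = ⇔-trans (∈-pl-columnOf⇔ A′ b) (⇔-sym ∈-reverse⇔)
    E₋ : ∀ {x} → mi x ∈ E ⇔ x ∈ b
    E₋ = ∈-mi-columnOf⇔ A′ b
    open Occupying E E₊ E₋
    range′ = proj₁ (proj₁ s′)
    sorted′ = proj₂ (proj₁ s′)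
    range = proj₁ (proj₁ s)
    sorted = proj₂ (proj₁ s)
    inc : IncColumn n E
    inc = columnOf-inRange (posVals-inSegment range′) (negVals-inSegment range) ,
          columnOf-sorted (posVals-increasing sorted′) (negVals-decreasing sorted)
    gaps-ts : GapsIn Occupied nothing ts zs
    gaps-ts = gapScan⇒gapsIn gaps
    len : length zs ≡ length ts
    len = sym (GapsIn-length ts zs gaps-ts)
    ts-unoccupied : ∀ {t} → t ∈ ts → ¬ t ∈ a′ × ¬ t ∈ b
    ts-unoccupied m = proj₂ (paired _) m
    frees : All (Free n E) ts
    frees = All.tabulate λ m → let 1≤t , t≤n = All.lookup (proj₂ ts-desc) m ; ∉a′ , ∉b = ts-unoccupied m
                               in 1≤t , t≤n , ∉a′ ∘ to E₊ , ∉b ∘ to E₋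
    zs⊆a′ : ∀ {z} → z ∈ zs → z ∈ a′
    zs⊆a′ m = proj₁ (to (proj₁ (paired _)) m)
    zs⊆b : ∀ {z} → z ∈ zs → z ∈ b
    zs⊆b m = proj₂ (to (proj₁ (paired _)) m)
    splits : SplitFrom n E nothing zs ts
    splits = gapsIn⇒splitFrom n E occupied? free⇒unoccupied unoccupied⇒free nothing zs ts gaps-ts frees
               (decreasing⇒Chain (proj₁ ts-desc)) (All.tabulate (λ m → inj₁ (zs⊆a′ m)))
    uz = Unique-decreasing (proj₁ zs-desc)
    ut = Unique-decreasing (proj₁ ts-desc)
    ps = zip zs ts
    open EquationalReasoning
    b′↭ : b′ ↭ map (lookupPair ps) b
    b′↭ = unique-set⇒↭ (Unique-decreasing (proj₁ (negVals-Desc s′)))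
            (Unique-map (Unique-decreasing (proj₁ (negVals-Desc s)))
               (lookupPair-injectiveOn zs ts ut len (λ (t∈ , t∈b) → proj₂ (ts-unoccupied t∈) t∈b)))
            λ {w} → begin
              w ∈ b′                                   ∼⟨ barred-replaced w ⟩
              ((w ∈ b × w ∉ zs) ⊎ w ∈ ts)              ∼⟨ ⇔-sym (lookupPair-image⇔ zs ts zs⊆b uz len) ⟩
              (∃ λ y → y ∈ b × lookupPair ps y ≡ w)    ∼⟨ ⇔-sym ∈-map⇔ ⟩
              w ∈ map (lookupPair ps) b                ∎
    A↭ : A ↭ map (lookupPair ps) A′
    A↭ = unique-set⇒↭ (Unique-increasing (posVals-increasing sorted))
           (Unique-map (Unique-increasing (posVals-increasing sorted′))
              (lookupPair-injectiveOn zs ts ut len (λ (t∈ , t∈A′) → proj₁ (ts-unoccupied t∈) (from ∈-reverse⇔ t∈A′))))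
           λ {w} → begin
             w ∈ A                                    ∼⟨ ⇔-sym ∈-reverse⇔ ⟩
             w ∈ a                                    ∼⟨ unbarred-replaced w ⟩
             ((w ∈ a′ × w ∉ zs) ⊎ w ∈ ts)             ∼⟨ (∈-reverse⇔ ×-⇔ ⇔-id _) ⊎-⇔ ⇔-id _ ⟩
             ((w ∈ A′ × w ∉ zs) ⊎ w ∈ ts)             ∼⟨ ⇔-sym (lookupPair-image⇔ zs ts (λ m → to ∈-reverse⇔ (zs⊆a′ m)) uz len) ⟩
             (∃ λ y → y ∈ A′ × lookupPair ps y ≡ w)   ∼⟨ ⇔-sym ∈-map⇔ ⟩
             w ∈ map (lookupPair ps) A′               ∎
    isR : IsR E zs ts D′
    isR = subst₂ _↭_ (sym (sorted-split sorted′)) (sym (rSubst-columnOf ps A′ b)) (++⁺ˡ (map pl A′) (↭.map⁺ mi b′↭))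
    isL : IsL E zs ts D
    isL = subst₂ _↭_ (sym (sorted-split sorted)) (sym (lSubst-columnOf ps A′ b)) (++⁺ʳ (map mi b) (↭.map⁺ pl A↭))

  cond3⇔word : Cond3 n D′ D ⇔ ColumnWord n D′ D
  cond3⇔word = mk⇔ cond3⇒word word⇒cond3

Intervals : (ℕ → Set) → List ℕ → List ℕ → Set
Intervals H xs ys = ∀ {x y} → (x , y) ∈ zip xs ys → ∀ w → x < w → w < y → H w

∈-zip⇒∈ʳ : ∀ {x y : ℕ} xs ys → (x , y) ∈ zip xs ys → y ∈ ys
∈-zip⇒∈ʳ (_ ∷ xs) (_ ∷ ys) (here refl) = here refl
∈-zip⇒∈ʳ (_ ∷ xs) (_ ∷ ys) (there m)   = there (∈-zip⇒∈ʳ xs ys m)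

∈-zip-swap : ∀ {x y : ℕ} xs ys → (x , y) ∈ zip xs ys → (y , x) ∈ zip ys xs
∈-zip-swap (_ ∷ xs) (_ ∷ ys) (here refl) = here refl
∈-zip-swap (_ ∷ xs) (_ ∷ ys) (there m)   = there (∈-zip-swap xs ys m)

∈-zip⇒∈ˡ : ∀ {x y : ℕ} xs ys → (x , y) ∈ zip xs ys → x ∈ xs
∈-zip⇒∈ˡ xs ys m = ∈-zip⇒∈ʳ ys xs (∈-zip-swap xs ys m)

private
  zip-reverseAcc : ∀ (acc acc′ xs ys : List ℕ) → length acc ≡ length acc′ → length xs ≡ length ys →
                   zip (reverseAcc acc xs) (reverseAcc acc′ ys) ≡ reverseAcc (zip acc acc′) (zip xs ys)
  zip-reverseAcc acc acc′ []       []       _   _   = refl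
  zip-reverseAcc acc acc′ (x ∷ xs) (y ∷ ys) len len′ =
    zip-reverseAcc (x ∷ acc) (y ∷ acc′) xs ys (cong suc len) (suc-injective len′)

∈-zip-reverse⇔ : ∀ {x y : ℕ} xs ys → length xs ≡ length ys →
                 (x , y) ∈ zip (reverse xs) (reverse ys) ⇔ (x , y) ∈ zip xs ys
∈-zip-reverse⇔ {x} {y} xs ys len =
  subst (λ Z → (x , y) ∈ Z ⇔ (x , y) ∈ zip xs ys) (sym (zip-reverseAcc [] [] xs ys refl len)) ∈-reverse⇔

Intervals-reverse⇔ : ∀ {H} xs ys → length xs ≡ length ys → Intervals H (reverse xs) (reverse ys) ⇔ Intervals H xs ys
Intervals-reverse⇔ xs ys len = mk⇔ (λ I {_} {_} m → I (from (∈-zip-reverse⇔ xs ys len) m))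
                                   (λ I {_} {_} m → I (to (∈-zip-reverse⇔ xs ys len) m))

Pointwise-flip : ∀ {R : ℕ → ℕ → Set} {xs ys} → Pointwise R xs ys → Pointwise (flip R) ys xs
Pointwise-flip []       = []
Pointwise-flip (r ∷ rs) = r ∷ Pointwise-flip rs

Pointwise-unreverse : ∀ {R : ℕ → ℕ → Set} {xs ys} → Pointwise R (reverse xs) (reverse ys) → Pointwise R xs ys
Pointwise-unreverse {xs = xs} {ys} p =
  subst₂ (Pointwise _) (reverse-involutive xs) (reverse-involutive ys) (Pointwise.reverse⁺ p)

intervals⇒gapsIn : ∀ {H} p xs ys → Pointwise _≤_ xs ys → Intervals H xs ys → All H ys → GapsIn H p xs ys
intervals⇒gapsIn p []       []       []           _ _          = tt
intervals⇒gapsIn p (x ∷ xs) (y ∷ ys) (x≤y ∷ x≤ys) I (Hy ∷ Hys) =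
  x≤y , gap , intervals⇒gapsIn (just x) xs ys x≤ys (I ∘ there) Hys
  where
  gap : ∀ w → x < w → w ≤ y → BelowN p w → _
  gap w x<w w≤y _ with w ≟ y
  ... | yes refl = Hy
  ... | no  w≢y  = I (here refl) w x<w (≤∧≢⇒< w≤y w≢y)

gapsIn⇒pointwise : ∀ {H p} xs ys → GapsIn H p xs ys → Pointwise _≤_ xs ys
gapsIn⇒pointwise []       []       _              = []
gapsIn⇒pointwise (_ ∷ xs) (_ ∷ ys) (x≤y , _ , gaps) = x≤y ∷ gapsIn⇒pointwise xs ys gaps

private
  -- An interval (x_j, y_j) with j > i is covered by the gap of (x_i, y_i) above x_i,
  -- by x_i itself, and by the later gaps below x_i.
  gapsIn⇒intervals′ : ∀ {H} p xs ys → GapsIn H p xs ys → AllPairs _>_ ys → All H xs →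
                      ∀ {x₀ y₀} → (x₀ , y₀) ∈ zip xs ys → ∀ w → x₀ < w → w < y₀ → BelowN p w → H w
  gapsIn⇒intervals′ p (x ∷ xs) (y ∷ ys) (_ , gap , _) _ _ (here refl) w x<w w<y below =
    gap w x<w (<⇒≤ w<y) below
  gapsIn⇒intervals′ p (x ∷ xs) (y ∷ ys) (_ , gap , gaps) (y>ys ∷ dec) (Hx ∷ Hxs) (there m) w x₀<w w<y₀ below
    with <-cmp w x
  ... | tri< w<x _ _ = gapsIn⇒intervals′ (just x) xs ys gaps dec Hxs m w x₀<w w<y₀ w<x
  ... | tri≈ _ refl _ = Hx
  ... | tri> _ _ x<w = gap w x<w (<⇒≤ (<-trans w<y₀ (All.lookup y>ys (∈-zip⇒∈ʳ xs ys m)))) below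

gapsIn⇒intervals : ∀ {H xs ys} → GapsIn H nothing xs ys → AllPairs _>_ ys → All H xs → Intervals H xs ys
gapsIn⇒intervals {xs = xs} {ys} gaps dec Hxs m w x<w w<y = gapsIn⇒intervals′ nothing xs ys gaps dec Hxs m w x<w w<y tt

∈-map-∣∣⇔ : ∀ D {x} → x ∈ map ∣_∣ₑ D ⇔ (pl x ∈ D ⊎ mi x ∈ D)
∈-map-∣∣⇔ D = mk⇔ entry [ ∈-map⁺ ∣_∣ₑ , ∈-map⁺ ∣_∣ₑ ]
  where
  entry : ∀ {x} → x ∈ map ∣_∣ₑ D → pl x ∈ D ⊎ mi x ∈ D
  entry m with ∈-map⁻ ∣_∣ₑ m
  ... | pl _ , m′ , refl = inj₁ m′
  ... | mi _ , m′ , refl = inj₂ m′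

private
  mi≰pl : ∀ {i j} → ¬ mi i ≤ₑ pl j
  mi≰pl (inj₁ ())
  mi≰pl (inj₂ ())

  pl≤pl⇒≤ : ∀ {x y} → pl x ≤ₑ pl y → x ≤ y
  pl≤pl⇒≤ (inj₁ (pl<pl x<y)) = <⇒≤ x<y
  pl≤pl⇒≤ (inj₂ refl)        = ≤-refl

  mi≤mi⇒≥ : ∀ {x y} → mi x ≤ₑ mi y → x ≥ y
  mi≤mi⇒≥ (inj₁ (mi<mi y<x)) = <⇒≤ y<x
  mi≤mi⇒≥ (inj₂ refl)        = ≤-refl

  ≤⇒pl≤pl : ∀ {x y} → x ≤ y → pl x ≤ₑ pl y
  ≤⇒pl≤pl x≤y with m≤n⇒m<n∨m≡n x≤y
  ... | inj₁ x<y  = inj₁ (pl<pl x<y)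
  ... | inj₂ refl = inj₂ refl

  ≥⇒mi≤mi : ∀ {x y} → x ≥ y → mi x ≤ₑ mi y
  ≥⇒mi≤mi y≤x with m≤n⇒m<n∨m≡n y≤x
  ... | inj₁ y<x  = inj₁ (mi<mi y<x)
  ... | inj₂ refl = inj₂ refl

R2⇒pointwise : ∀ n A B A′ B′ → R2 n (columnOf A′ B′) (columnOf A B) → Pointwise _≤_ A A′ × Pointwise _≥_ B B′
R2⇒pointwise n (_ ∷ A) B (_ ∷ A′) B′ (inj₁ (x≤x′ , _) ∷ r2) =
  map₁ (pl≤pl⇒≤ x≤x′ ∷_) (R2⇒pointwise n A B A′ B′ r2)
R2⇒pointwise n (_ ∷ A) B (_ ∷ A′) B′ (inj₂ (n̄≤pl , _) ∷ _) = ⊥-elim (mi≰pl n̄≤pl)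
R2⇒pointwise n [] B [] B′ r2 = [] , onlyBarred B B′ r2
  where
  onlyBarred : ∀ B B′ → R2 n (map mi B′) (map mi B) → Pointwise _≥_ B B′
  onlyBarred []      []       []                       = []
  onlyBarred (_ ∷ B) (_ ∷ B′) (inj₁ (_ , mi≤n) ∷ _)  = ⊥-elim (mi≰pl mi≤n)
  onlyBarred (_ ∷ B) (_ ∷ B′) (inj₂ (_ , y≤y′) ∷ r2) = mi≤mi⇒≥ y≤y′ ∷ onlyBarred B B′ r2
R2⇒pointwise n (_ ∷ A) B [] (_ ∷ B′) (inj₁ (_ , mi≤n) ∷ _)   = ⊥-elim (mi≰pl mi≤n)
R2⇒pointwise n (_ ∷ A) B [] (_ ∷ B′) (inj₂ (n̄≤pl , _) ∷ _)   = ⊥-elim (mi≰pl n̄≤pl)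
R2⇒pointwise n [] (_ ∷ B) (_ ∷ A′) B′ (inj₁ (mi≤pl , _) ∷ _) = ⊥-elim (mi≰pl mi≤pl)
R2⇒pointwise n [] (_ ∷ B) (_ ∷ A′) B′ (inj₂ (_ , mi≤pl) ∷ _) = ⊥-elim (mi≰pl mi≤pl)

pointwise⇒R2 : ∀ n A B A′ B′ → Pointwise _≤_ A A′ → Pointwise _≥_ B B′ → All (InSegment n) A′ → All (InSegment n) B →
               R2 n (columnOf A′ B′) (columnOf A B)
pointwise⇒R2 n (_ ∷ A) B (_ ∷ A′) B′ (x≤x′ ∷ A≤A′) B≥B′ ((_ , x′≤n) ∷ rA′) rB =
  inj₁ (≤⇒pl≤pl x≤x′ , ≤⇒pl≤pl x′≤n) ∷ pointwise⇒R2 n A B A′ B′ A≤A′ B≥B′ rA′ rB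
pointwise⇒R2 n [] B [] B′ [] B≥B′ _ rB = onlyBarred B B′ B≥B′ rB
  where
  onlyBarred : ∀ B B′ → Pointwise _≥_ B B′ → All (InSegment n) B → R2 n (map mi B′) (map mi B)
  onlyBarred []      []       []            _                 = []
  onlyBarred (_ ∷ B) (_ ∷ B′) (y≥y′ ∷ B≥B′) ((_ , y≤n) ∷ rB) =
    inj₂ (≥⇒mi≤mi y≤n , ≥⇒mi≤mi y≥y′) ∷ onlyBarred B B′ B≥B′ rB

∈-zip-columnOf-pl : ∀ {x x′} A B A′ B′ → (x , x′) ∈ zip A A′ → (pl x , pl x′) ∈ zip (columnOf A B) (columnOf A′ B′)
∈-zip-columnOf-pl (_ ∷ A) B (_ ∷ A′) B′ (here refl) = here refl
∈-zip-columnOf-pl (_ ∷ A) B (_ ∷ A′) B′ (there m)   = there (∈-zip-columnOf-pl A B A′ B′ m)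

∈-zip-columnOf-mi : ∀ {y y′} A B A′ B′ → length A ≡ length A′ → (y , y′) ∈ zip B B′ →
                    (mi y , mi y′) ∈ zip (columnOf A B) (columnOf A′ B′)
∈-zip-columnOf-mi (_ ∷ A) B (_ ∷ A′) B′ len m = there (∈-zip-columnOf-mi A B A′ B′ (suc-injective len) m)
∈-zip-columnOf-mi []      B []      B′ _   m = onlyBarred B B′ m
  where
  onlyBarred : ∀ {y y′} B B′ → (y , y′) ∈ zip B B′ → (mi y , mi y′) ∈ zip (map mi B) (map mi B′)
  onlyBarred (_ ∷ B) (_ ∷ B′) (here refl) = here refl
  onlyBarred (_ ∷ B) (_ ∷ B′) (there m)   = there (onlyBarred B B′ m)

∈-zip-columnOf⁻ : ∀ {c c′} A B A′ B′ → length A ≡ length A′ → (c , c′) ∈ zip (columnOf A B) (columnOf A′ B′) →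
                  (∃ λ x → ∃ λ x′ → c ≡ pl x × c′ ≡ pl x′ × (x , x′) ∈ zip A A′) ⊎
                  (∃ λ y → ∃ λ y′ → c ≡ mi y × c′ ≡ mi y′ × (y , y′) ∈ zip B B′)
∈-zip-columnOf⁻ (x ∷ A) B (x′ ∷ A′) B′ _ (here refl) = inj₁ (x , x′ , refl , refl , here refl)
∈-zip-columnOf⁻ (_ ∷ A) B (_ ∷ A′) B′ len (there m) with ∈-zip-columnOf⁻ A B A′ B′ (suc-injective len) m
... | inj₁ (x , x′ , c≡ , c′≡ , m′) = inj₁ (x , x′ , c≡ , c′≡ , there m′)
... | inj₂ onlyBarred                  = inj₂ onlyBarred
∈-zip-columnOf⁻ [] B [] B′ _ m = inj₂ (onlyBarred B B′ m)
  where
  onlyBarred : ∀ {c c′} B B′ → (c , c′) ∈ zip (map mi B) (map mi B′) →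
           ∃ λ y → ∃ λ y′ → c ≡ mi y × c′ ≡ mi y′ × (y , y′) ∈ zip B B′
  onlyBarred (y ∷ B) (y′ ∷ B′) (here refl) = y , y′ , refl , refl , here refl
  onlyBarred (_ ∷ B) (_ ∷ B′) (there m) with onlyBarred B B′ m
  ... | y , y′ , c≡ , c′≡ , m′ = y , y′ , c≡ , c′≡ , there m′

module _ (n : ℕ) (A B A′ B′ : List ℕ) (len : length A ≡ length A′) where
  private
    D  = columnOf A B
    D′ = columnOf A′ B′

    Occurs : ℕ → Set
    Occurs w = w ∈ A ⊎ w ∈ B

    occurs-pl⇔ : ∀ w → (pl w ∈ D ⊎ bar (pl w) ∈ D) ⇔ Occurs w
    occurs-pl⇔ w = ∈-pl-columnOf⇔ A B ⊎-⇔ ∈-mi-columnOf⇔ A B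

    occurs-mi⇔ : ∀ w → (mi w ∈ D ⊎ bar (mi w) ∈ D) ⇔ Occurs w
    occurs-mi⇔ w = ⇔-trans (mk⇔ Sum.swap Sum.swap) (occurs-pl⇔ w)

  R3⇒intervals : All (InSegment n) A → All (InSegment n) A′ → All (InSegment n) B → All (InSegment n) B′ →
                 R3 n D′ D → Intervals Occurs A A′ × Intervals Occurs B′ B
  R3⇒intervals rA rA′ rB rB′ r3 = unbarred-intervals , barred-intervals
    where
    unbarred-intervals : Intervals Occurs A A′
    unbarred-intervals {x} {x′} m w x<w w<x′ =
      to (occurs-pl⇔ w) (r3 (pl w)
        (≤-trans (proj₁ (All.lookup rA (∈-zip⇒∈ˡ A A′ m))) (<⇒≤ x<w) ,
         ≤-trans (<⇒≤ w<x′) (proj₂ (All.lookup rA′ (∈-zip⇒∈ʳ A A′ m))))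
        (pl x , pl x′ , ∈-zip-columnOf-pl A B A′ B′ m , pl<pl x<w , pl<pl w<x′))
    barred-intervals : Intervals Occurs B′ B
    barred-intervals {y′} {y} m w y′<w w<y =
      to (occurs-mi⇔ w) (r3 (mi w)
        (≤-trans (proj₁ (All.lookup rB′ (∈-zip⇒∈ˡ B′ B m))) (<⇒≤ y′<w) ,
         ≤-trans (<⇒≤ w<y) (proj₂ (All.lookup rB (∈-zip⇒∈ʳ B′ B m))))
        (mi y , mi y′ , ∈-zip-columnOf-mi A B A′ B′ len (∈-zip-swap B′ B m) , mi<mi w<y , mi<mi y′<w))

  intervals⇒R3 : Intervals Occurs A A′ → Intervals Occurs B′ B → R3 n D′ D
  intervals⇒R3 IA IB j _ (c , c′ , m , c<j , j<c′) with ∈-zip-columnOf⁻ A B A′ B′ len m | j | c<j | j<c′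
  ... | inj₁ (x , x′ , refl , refl , m′) | pl w | pl<pl x<w | pl<pl w<x′ = from (occurs-pl⇔ w) (IA m′ w x<w w<x′)
  ... | inj₁ (_ , _ , refl , refl , _)   | mi w | pl<mi     | ()
  ... | inj₂ (y , y′ , refl , refl , m′) | mi w | mi<mi w<y | mi<mi y′<w =
    from (occurs-mi⇔ w) (IB (∈-zip-swap B B′ m′) w y′<w w<y)
  ... | inj₂ (_ , _ , refl , refl , _)   | pl w | ()        | _

-- Condition (1)

R1⇔sameValues : ∀ {D′ D} → R1 D′ D ⇔ Valuewise SameValues (posDesc D) (posDesc D′) (negVals D) (negVals D′)
R1⇔sameValues {D′} {D} =
  mk⇔ (λ r1 w → ⇔-trans (⇔-sym (values D)) (⇔-trans (r1 w) (values D′)))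
      (λ same w → ⇔-trans (values D) (⇔-trans (same w) (⇔-sym (values D′))))
  where
  values : ∀ C {w} → w ∈ map ∣_∣ₑ C ⇔ (w ∈ posDesc C ⊎ w ∈ negVals C)
  values C = ⇔-trans (∈-map-∣∣⇔ C) (⇔-sym (∈-posDesc⇔ C ⊎-⇔ ∈-negVals⇔ C))

module _ {n D′ D} (s′ : SortedColumn n D′) (s : SortedColumn n D) where
  private
    A  = posVals D
    A′ = posVals D′
    a  = posDesc D
    a′ = posDesc D′
    b  = negVals D
    b′ = negVals D′

    Occurs : ℕ → Set
    Occurs w = w ∈ A ⊎ w ∈ b

    occurs-reverse : ∀ {w} → w ∈ a ⊎ w ∈ b → Occurs w
    occurs-reverse = Sum.map₁ (to ∈-reverse⇔)

    D≡ : D ≡ columnOf A b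
    D≡ = sorted-split (proj₂ (proj₁ s))
    D′≡ : D′ ≡ columnOf A′ b′
    D′≡ = sorted-split (proj₂ (proj₁ s′))

    rA  = posVals-inSegment (proj₁ (proj₁ s))
    rA′ = posVals-inSegment (proj₁ (proj₁ s′))
    rb  = negVals-inSegment (proj₁ (proj₁ s))
    rb′ = negVals-inSegment (proj₁ (proj₁ s′))

  cond1⇒word : Cond1 n D′ D → ColumnWord n D′ D
  cond1⇒word (r1 , r2 , r3) =
    gaps-R1⇒word (gapsIn⇒gapScan (posDesc-Desc s) (posDesc-Desc s′) gaps-a)
                 (gapsIn⇒gapScan (negVals-Desc s′) (negVals-Desc s) gaps-b)
                 same (sorted-disjoint s) (sorted-disjoint s′) (λ _ _ → Sum.map₁ (from ∈-reverse⇔))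
                 (posDesc-Desc s) (posDesc-Desc s′) (negVals-Desc s) (negVals-Desc s′)
    where
    same = to R1⇔sameValues r1
    pointwise = R2⇒pointwise n A b A′ b′ (subst₂ (R2 n) D′≡ D≡ r2)
    len = Pointwise-length (proj₁ pointwise)
    intervals = R3⇒intervals n A b A′ b′ len rA rA′ rb rb′ (subst₂ (R3 n) D′≡ D≡ r3)
    gaps-a : GapsIn Occurs nothing a a′
    gaps-a = intervals⇒gapsIn nothing a a′ (Pointwise.reverse⁺ (proj₁ pointwise))
               (from (Intervals-reverse⇔ A A′ len) (proj₁ intervals))
               (All.tabulate λ m → occurs-reverse (from (same _) (inj₁ m)))
    gaps-b : GapsIn Occurs nothing b′ b
    gaps-b = intervals⇒gapsIn nothing b′ b (Pointwise-flip (proj₂ pointwise)) (proj₂ intervals) (All.tabulate inj₂)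

  word⇒cond1 : ColumnWord n D′ D → Cond1 n D′ D
  word⇒cond1 word with word⇒gaps-R1 {H = Occurs} word (λ m → inj₁ (to ∈-reverse⇔ m)) inj₂
  ... | scan-a , scan-b , same =
    from R1⇔sameValues same ,
    subst₂ (R2 n) (sym D′≡) (sym D≡) (pointwise⇒R2 n A b A′ b′ A≤A′ b≥b′ rA′ rb) ,
    subst₂ (R3 n) (sym D′≡) (sym D≡) (intervals⇒R3 n A b A′ b′ len intervals-a intervals-b)
    where
    gaps-a = gapScan⇒gapsIn scan-a
    gaps-b = gapScan⇒gapsIn scan-b
    A≤A′ = Pointwise-unreverse (gapsIn⇒pointwise a a′ gaps-a)
    b≥b′ = Pointwise-flip (gapsIn⇒pointwise b′ b gaps-b)
    len = Pointwise-length A≤A′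
    intervals-a = to (Intervals-reverse⇔ A A′ len)
                    (gapsIn⇒intervals gaps-a (proj₁ (posDesc-Desc s′)) (All.tabulate λ m → inj₁ (to ∈-reverse⇔ m)))
    intervals-b = gapsIn⇒intervals gaps-b (proj₁ (negVals-Desc s))
                    (All.tabulate λ m → occurs-reverse (from (same _) (inj₂ m)))

  cond1⇔word : Cond1 n D′ D ⇔ ColumnWord n D′ D
  cond1⇔word = mk⇔ cond1⇒word word⇒cond1

proposition8p8 : (n : ℕ) (D' D : List Ent) →
    SortedColumn n D' → SortedColumn n D → length D' ≡ length D →
    (Cond1 n D' D ⇔ Cond2 D' D) × (Cond1 n D' D ⇔ Cond3 n D' D)
proposition8p8 n D′ D s′ s _ =
  ⇔-trans (cond1⇔word s′ s) (⇔-sym (cond2⇔word s′ s)) ,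
  ⇔-trans (cond1⇔word s′ s) (⇔-sym (cond3⇔word s′ s))
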